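{- Let $r$ be a power of the prime $p$, consider a Desarguesian net of order $r$ and degree $m\ge 1$ with collinearity graph $\Gamma$, let $L$ be a line of the net and $x$ a point not on $L$, and let $C_{x,L}$ be the unique maximal clique of $\Gamma$ containing $\{x\}\cup(x^\perp\cap L)$. Let $G_{x,L}$ be the group of linear transformations of the net (maps $z\mapsto cz+d$ of $\mathbb{F}_{r^2}$ with $c\in\mathbb{F}_r^*$, $d\in\mathbb{F}_{r^2}$) that stabilize both $L$ and $C_{x,L}$. Then $G_{x,L}$ is transitive on $C_{x,L}\setminus L$.
   Context: A Desarguesian net of order $r$ and degree $m$: identify the point set with $\mathbb{F}_{r^2}$ and fix $S\subseteq\mathbb{F}_{r^2}^*$, a union of $m$ cosets of $\mathbb{F}_r^*$ in $\mathbb{F}_{r^2}^*$. Lines of the net are the sets $a+d\,\mathbb{F}_r$ with $a\in\mathbb{F}_{r^2}$, $d\in S$. The collinearity graph $\Gamma$ has vertex set $\mathbb{F}_{r^2}$, distinct vertices adjacent iff their difference lies in $S$. For a vertex $y$, $y^\perp$ is $\{y\}$ together with the neighbours of $y$. It is known that $\{x\}\cup(x^\perp\cap L)$ is a clique contained in a unique maximal clique, denoted $C_{x,L}$. Maps $z\mapsto cz+d$ with $c\in\mathbb{F}_r^*$ preserve directions and hence are automorphisms of the net. -}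

module Defs where

open import Level using (0ℓ)
open import Data.Nat using (ℕ; zero; suc) renaming (_*_ to _*ℕ_)
open import Data.Fin using (Fin)
open import Data.Product using (Σ; ∃; _×_; _,_)
open import Relation.Binary.PropositionalEquality using (_≡_; _≢_)
open import Relation.Nullary using (¬_)
open import Algebra.Core using (Op₁; Op₂)
open import Data.Sum using (_⊎_)
open import Function.Bundles using (_↔_)
import Algebra.Structures as AS

record FiniteField (q : ℕ) : Set₁ where
  field
    K    : Set
    _+_  : Op₂ K
    _*_  : Op₂ K
    -_   : Op₁ K
    0#   : K
    1#   : K
    isCommutativeRing : AS.IsCommutativeRing {A = K} _≡_ _+_ _*_ -_ 0# 1#
    0≢1  : 0# ≢ 1#
    inverse : ∀ x → x ≢ 0# → ∃ λ y → x * y ≡ 1#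
    card : Fin q ↔ K
  infixl 6 _+_ _-_
  infixl 7 _*_
  _-_ : Op₂ K
  x - y = x + (- y)
  _^_ : K → ℕ → K
  x ^ zero = 1#
  x ^ suc n = x * (x ^ n)

-- Setting: F = 𝔽_{r²}; the subfield 𝔽_r is { z | z ^ r ≡ z }.
module Net {r : ℕ} (F : FiniteField (r *ℕ r)) where
  open FiniteField F public

  Pred : Set₁
  Pred = K → Set

  InFr : K → Set
  InFr z = z ^ r ≡ z

  InFr* : K → Set
  InFr* z = InFr z × z ≢ 0#

  -- S is a union of m distinct cosets of 𝔽_r^* in 𝔽_{r²}^*,
  -- given by coset representatives d : Fin m → K.
  IsDirectionSet : (m : ℕ) → Pred → Set
  IsDirectionSet m S =
    Σ (Fin m → K) λ d →
        (∀ i → d i ≢ 0#)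
      × (∀ i j → i ≢ j → ¬ (∃ λ c → InFr* c × d i ≡ c * d j))
      × (∀ z → (S z → ∃ λ i → ∃ λ c → InFr* c × z ≡ c * d i)
             × ((∃ λ i → ∃ λ c → InFr* c × z ≡ c * d i) → S z))

  OnLine : K → K → K → Set
  OnLine a d z = ∃ λ t → InFr t × z ≡ a + d * t

  Adj : Pred → K → K → Set
  Adj S y z = y ≢ z × S (y - z)

  Perp : Pred → K → K → Set
  Perp S y z = (z ≡ y) ⊎ Adj S y z

  IsClique : Pred → Pred → Set
  IsClique S C = ∀ y z → C y → C z → y ≢ z → Adj S y z

  IsMaximalClique : Pred → Pred → Set₁
  IsMaximalClique S C =
    IsClique S C × (∀ (D : Pred) → IsClique S D → (∀ z → C z → D z) → ∀ z → D z → C z)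

  aff : K → K → K → K
  aff c e z = c * z + e

  Stabilizes : (K → K) → Pred → Set
  Stabilizes g P = ∀ z → (P z → P (g z)) × (P (g z) → P z)

-- In the coordinate t = (z - a) / d the line L is the subfield 𝔽ᵣ, and the coordinate w of x
-- is not in 𝔽ᵣ, so {1, w} is an 𝔽ᵣ-basis and every point z off L has coordinate α + β w with β ≠ 0; let
-- h_z be the affine map μ ↦ β μ + α of 𝔽ᵣ, and A ⊆ 𝔽ᵣ the coordinates of the points of L adjacent to x.
-- A point z of C off L is adjacent to those points, so h_z⁻¹ maps A into A; as affine maps of 𝔽ᵣ have
-- finite order, h_z permutes A. Two points y, z off L are adjacent iff h_z⁻¹ ∘ h_y is a translation or fixes
-- a point of A, and among the affine maps permuting A this property is closed under composition, because
-- the fixed points of two of them differ by a period of A (obtained from their commutator). For u, v in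
-- C off L, the net automorphism acting on coordinates as h_v ∘ h_u⁻¹ preserves L, sends u to v, maps C ∩ L into
-- C, and maps a point z of C off L to a point adjacent to all of C, hence into C by maximality.

module Submission where

open import Defs
open import Level using (0ℓ)
open import Data.Nat as ℕ using (ℕ; zero; suc; _∸_; _!)
import Data.Nat.Properties as ℕ
open import Data.Integer as ℤ using (ℤ; -[1+_]; _⊖_)
import Data.Integer.Properties as ℤ
open import Data.Sign as Sign using (Sign)
import Data.Maybe as Maybe
open import Data.Product using (∃; _×_; _,_; proj₁; proj₂)
open import Data.Sum using (_⊎_; inj₁; inj₂; reduce)
open import Data.Empty using (⊥-elim)
open import Data.Fin as Fin using (Fin; punchIn)
import Data.Fin.Properties as Finₚ
open import Algebra.Bundles using (CommutativeRing; CommutativeMonoid)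
open import Algebra.Structures using (IsCommutativeMonoid)
open import Algebra.Core using (Op₂)
import Algebra.Properties.CommutativeMonoid.Sum
import Algebra.Properties.CommutativeSemiring.Binomial
import Algebra.Properties.Semiring.Exp
open import Data.Nat.Combinatorics using (nCn≡1; nCk≡n!/k![n-k]!; k![n∸k]!∣n!) renaming (_C_ to _choose_)
open import Data.Nat.Divisibility using (_∣_; _∤_; divides; ∣⇒≤; ∣1⇒≡1; m∣m*n)
open import Data.Nat.DivMod using (m/n*n≡m)
open import Data.Nat.Primality using (Prime; euclidsLemma; ¬prime[1]; prime⇒nonZero; prime⇒nonTrivial)
open import Algebra.Solver.Ring.AlmostCommutativeRing
  using (fromCommutativeRing; _-Raw-AlmostCommutative⟶_)
import Algebra.Solver.Ring
import Algebra.Properties.Ring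
import Algebra.Properties.Monoid.Mult
import Algebra.Properties.Semiring.Mult
import Algebra.Properties.Monoid.Mult.TCOptimised
import Algebra.Properties.Semiring.Mult.TCOptimised
import Algebra.Properties.CommutativeSemigroup
open import Function.Base using (_∘_; _⟨_⟩_)
open import Data.Vec.Functional using (removeAt)
open import Function.Bundles using (Inverse; mk↔ₛ′)
open import Function.Properties.Inverse using (↔-sym; ↔-trans; Inverse⇒Injection)
open import Relation.Binary.Definitions using (DecidableEquality)
open import Relation.Binary.PropositionalEquality
open import Relation.Nullary using (¬_; Dec; yes; no)
open import Relation.Nullary.Decidable using (dec⇒maybe)

-- Binomial coefficients modulo a prime

n∣n! : ∀ n → .{{ℕ.NonZero n}} → n ∣ n !
n∣n! (suc n) = m∣m*n (n !)

module _ {p : ℕ} (p-prime : Prime p) where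

  prime∤n! : ∀ {n} → n ℕ.< p → p ∤ n !
  prime∤n! {zero}  _   p∣1   = ¬prime[1] (subst Prime (∣1⇒≡1 p∣1) p-prime)
  prime∤n! {suc n} n<p p∣n! with euclidsLemma (suc n) (n !) p-prime p∣n!
  ... | inj₁ p∣1+n = ℕ.<⇒≱ n<p (∣⇒≤ p∣1+n)
  ... | inj₂ p∣n!′ = prime∤n! (ℕ.<-trans (ℕ.n<1+n n) n<p) p∣n!′

  prime∣pCj : ∀ {j} → 0 ℕ.< j → j ℕ.< p → p ∣ p choose j
  prime∣pCj {j} 0<j j<p with euclidsLemma (p choose j) (j ! ℕ.* (p ∸ j) !) p-prime p∣pCj*j![p-j]!
    where
    instance
      j![p-j]!≢0 : ℕ.NonZero (j ! ℕ.* (p ∸ j) !)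
      j![p-j]!≢0 = ℕ._!*_!≢0 j (p ∸ j)
    p∣pCj*j![p-j]! : p ∣ (p choose j) ℕ.* (j ! ℕ.* (p ∸ j) !)
    p∣pCj*j![p-j]! = subst (p ∣_)
      (sym (trans (cong (ℕ._* (j ! ℕ.* (p ∸ j) !)) (nCk≡n!/k![n-k]! (ℕ.<⇒≤ j<p))) (m/n*n≡m (k![n∸k]!∣n! (ℕ.<⇒≤ j<p)))))
      (n∣n! p {{prime⇒nonZero p-prime}})
  ... | inj₁ p∣pCj = p∣pCj
  ... | inj₂ p∣j![p-j]! with euclidsLemma (j !) ((p ∸ j) !) p-prime p∣j![p-j]!
  ...   | inj₁ p∣j!     = ⊥-elim (prime∤n! j<p p∣j!)
  ...   | inj₂ p∣[p-j]! = ⊥-elim (prime∤n! (ℕ.∸-monoʳ-< {p} {j} {0} 0<j (ℕ.<⇒≤ j<p)) p∣[p-j]!)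

-- Finite fields

module FieldProperties {q : ℕ} (F : FiniteField q) where
  open FiniteField F public

  commutativeRing : CommutativeRing 0ℓ 0ℓ
  commutativeRing = record { isCommutativeRing = isCommutativeRing }

  open CommutativeRing commutativeRing public
    using ( +-assoc; +-comm; +-identityˡ; +-identityʳ; -‿inverseˡ; -‿inverseʳ
          ; *-assoc; *-comm; *-identityˡ; *-identityʳ; zeroˡ; zeroʳ
          ; +-monoid; +-rawMonoid; semiring; ring; *-commutativeSemigroup
          ; +-isCommutativeMonoid; *-isCommutativeMonoid; commutativeSemiring)
  open Algebra.Properties.Ring ring public
    using (-‿involutive; -0#≈0#; -‿anti-homo-+; -1*x≈-x)
  open Algebra.Properties.Monoid.Mult +-monoid public using (×-assocˡ)
  open Algebra.Properties.Semiring.Mult semiring public using (×-assoc-*)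
  open import Algebra.Definitions.RawMonoid +-rawMonoid public using () renaming (_×_ to _·_)

  open Algebra.Properties.CommutativeSemigroup *-commutativeSemigroup using (interchange)

  open Algebra.Properties.Monoid.Mult.TCOptimised +-monoid
    using (1+×; ×ᵤ≈×) renaming (_×_ to _·′_; ×-homo-+ to ·′-homo-+)
  open Algebra.Properties.Semiring.Mult.TCOptimised semiring public using () renaming (×1-homo-* to ·′1-homo-*)

  -- The ring solver normalises with coefficients in ℤ, so it needs the ring map ℤ → K.
  -- The optimised multiple makes fromℕ 1 reduce to 1#, as the solver's constant :1 requires.
  fromℕ : ℕ → K
  fromℕ n = n ·′ 1#

  ·1≡fromℕ : ∀ n → n · 1# ≡ fromℕ n
  ·1≡fromℕ n = ×ᵤ≈× n 1#

  fromℤ : ℤ → K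
  fromℤ (ℤ.+ n)    = fromℕ n
  fromℤ -[1+ n ] = - fromℕ (suc n)

  x-y≡[a+x]-[a+y] : ∀ a x y → x - y ≡ (a + x) - (a + y)
  x-y≡[a+x]-[a+y] a x y = sym (begin
    (a + x) - (a + y)       ≡⟨ cong₂ _+_ (+-comm a x) (-‿anti-homo-+ a y) ⟩
    (x + a) + (- y + - a)   ≡⟨ cong ((x + a) +_) (+-comm (- y) (- a)) ⟩
    (x + a) + (- a + - y)   ≡⟨ +-assoc x a _ ⟩
    x + (a + (- a + - y))   ≡⟨ cong (x +_) (+-assoc a (- a) (- y)) ⟨
    x + ((a - a) + - y)     ≡⟨ cong (λ t → x + (t + - y)) (-‿inverseʳ a) ⟩
    x + (0# + - y)          ≡⟨ cong (x +_) (+-identityˡ (- y)) ⟩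
    x - y                   ∎)
    where open ≡-Reasoning

  fromℤ-⊖ : ∀ m n → fromℤ (m ⊖ n) ≡ fromℕ m - fromℕ n
  fromℤ-⊖ m zero = begin
    fromℤ (m ⊖ 0)   ≡⟨ cong fromℤ (ℤ.⊖-≥ {m} {0} ℕ.z≤n) ⟩
    fromℕ m         ≡⟨ +-identityʳ (fromℕ m) ⟨
    fromℕ m + 0#    ≡⟨ cong (fromℕ m +_) -0#≈0# ⟨
    fromℕ m - 0#    ∎
    where open ≡-Reasoning
  fromℤ-⊖ zero (suc n) =
    trans (cong fromℤ (ℤ.⊖-< {0} {suc n} (ℕ.s≤s ℕ.z≤n))) (sym (+-identityˡ _))
  fromℤ-⊖ (suc m) (suc n) = begin
    fromℤ (suc m ⊖ suc n)                ≡⟨ cong fromℤ (ℤ.[1+m]⊖[1+n]≡m⊖n m n) ⟩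
    fromℤ (m ⊖ n)                        ≡⟨ fromℤ-⊖ m n ⟩
    fromℕ m - fromℕ n                    ≡⟨ x-y≡[a+x]-[a+y] 1# (fromℕ m) (fromℕ n) ⟩
    (1# + fromℕ m) - (1# + fromℕ n)      ≡⟨ cong₂ _-_ (1+× m 1#) (1+× n 1#) ⟨
    fromℕ (suc m) - fromℕ (suc n)        ∎
    where open ≡-Reasoning

  fromℤ-+ : ∀ i j → fromℤ (i ℤ.+ j) ≡ fromℤ i + fromℤ j
  fromℤ-+ (ℤ.+ m)    (ℤ.+ n)    = ·′-homo-+ 1# m n
  fromℤ-+ (ℤ.+ m)    -[1+ n ] = fromℤ-⊖ m (suc n)
  fromℤ-+ -[1+ m ] (ℤ.+ n)    = trans (fromℤ-⊖ n (suc m)) (+-comm _ _)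
  fromℤ-+ -[1+ m ] -[1+ n ] = begin
    - fromℕ (suc (suc (m ℕ.+ n)))          ≡⟨ cong (λ t → - fromℕ (suc t)) (ℕ.+-suc m n) ⟨
    - fromℕ (suc m ℕ.+ suc n)              ≡⟨ cong -_ (·′-homo-+ 1# (suc m) (suc n)) ⟩
    - (fromℕ (suc m) + fromℕ (suc n))      ≡⟨ -‿anti-homo-+ _ _ ⟩
    - fromℕ (suc n) + - fromℕ (suc m)      ≡⟨ +-comm _ _ ⟩
    - fromℕ (suc m) + - fromℕ (suc n)      ∎
    where open ≡-Reasoning

  fromℤ-neg : ∀ i → fromℤ (ℤ.- i) ≡ - fromℤ i
  fromℤ-neg (ℤ.+ zero)  = sym -0#≈0#
  fromℤ-neg (ℤ.+ suc n) = refl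
  fromℤ-neg -[1+ n ]  = sym (-‿involutive _)

  fromSign : Sign → K
  fromSign Sign.+ = 1#
  fromSign Sign.- = - 1#

  fromSign-* : ∀ s t → fromSign (s Sign.* t) ≡ fromSign s * fromSign t
  fromSign-* Sign.+ t      = sym (*-identityˡ _)
  fromSign-* Sign.- Sign.+ = sym (*-identityʳ _)
  fromSign-* Sign.- Sign.- = sym (trans (-1*x≈-x (- 1#)) (-‿involutive 1#))

  fromℤ-◃ : ∀ s n → fromℤ (s ℤ.◃ n) ≡ fromSign s * fromℕ n
  fromℤ-◃ s      zero    = sym (zeroʳ _)
  fromℤ-◃ Sign.+ (suc n) = sym (*-identityˡ _)
  fromℤ-◃ Sign.- (suc n) = sym (-1*x≈-x _)

  fromℤ-* : ∀ i j → fromℤ (i ℤ.* j) ≡ fromℤ i * fromℤ j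
  fromℤ-* i j = begin
    fromℤ (i ℤ.* j)
      ≡⟨ fromℤ-◃ (ℤ.sign i Sign.* ℤ.sign j) (ℤ.∣ i ∣ ℕ.* ℤ.∣ j ∣) ⟩
    fromSign (ℤ.sign i Sign.* ℤ.sign j) * fromℕ (ℤ.∣ i ∣ ℕ.* ℤ.∣ j ∣)
      ≡⟨ cong₂ _*_ (fromSign-* (ℤ.sign i) (ℤ.sign j)) (·′1-homo-* ℤ.∣ i ∣ ℤ.∣ j ∣) ⟩
    (fromSign (ℤ.sign i) * fromSign (ℤ.sign j)) * (fromℕ ℤ.∣ i ∣ * fromℕ ℤ.∣ j ∣)
      ≡⟨ interchange _ _ _ _ ⟩
    (fromSign (ℤ.sign i) * fromℕ ℤ.∣ i ∣) * (fromSign (ℤ.sign j) * fromℕ ℤ.∣ j ∣)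
      ≡⟨ cong₂ _*_ (fromℤ-◃ (ℤ.sign i) ℤ.∣ i ∣) (fromℤ-◃ (ℤ.sign j) ℤ.∣ j ∣) ⟨
    fromℤ (ℤ.sign i ℤ.◃ ℤ.∣ i ∣) * fromℤ (ℤ.sign j ℤ.◃ ℤ.∣ j ∣)
      ≡⟨ cong₂ (λ s t → fromℤ s * fromℤ t) (ℤ.◃-inverse i) (ℤ.◃-inverse j) ⟩
    fromℤ i * fromℤ j ∎
    where open ≡-Reasoning

  fromℤ-homomorphism : ℤ.+-*-rawRing -Raw-AlmostCommutative⟶ fromCommutativeRing commutativeRing
  fromℤ-homomorphism = record
    { ⟦_⟧ = fromℤ ; +-homo = fromℤ-+ ; *-homo = fromℤ-* ; -‿homo = fromℤ-neg
    ; 0-homo = refl ; 1-homo = refl }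

  fromℤ-≟ : ∀ i j → Maybe.Maybe (fromℤ i ≡ fromℤ j)
  fromℤ-≟ i j = Maybe.map (cong fromℤ) (dec⇒maybe (i ℤ.≟ j))

  module RingSolver = Algebra.Solver.Ring ℤ.+-*-rawRing (fromCommutativeRing commutativeRing) fromℤ-homomorphism fromℤ-≟

  open RingSolver public using (solve; _:=_; _:+_; _:*_; _:-_; :-_; con; Polynomial)

  :1 : ∀ {n} → Polynomial n
  :1 = con (ℤ.+ 1)

  infix 4 _≟_
  _≟_ : DecidableEquality K
  _≟_ = Finₚ.inj⇒≟ (Inverse⇒Injection (↔-sym card))

  x-y≡0⇒x≡y : ∀ {x y} → x - y ≡ 0# → x ≡ y
  x-y≡0⇒x≡y {x} {y} x-y≡0 = begin
    x              ≡⟨ solve 2 (λ x y → x := (x :- y) :+ y) refl x y ⟩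
    (x - y) + y    ≡⟨ cong (_+ y) x-y≡0 ⟩
    0# + y         ≡⟨ +-identityˡ y ⟩
    y              ∎
    where open ≡-Reasoning

  x≢y⇒x-y≢0 : ∀ {x y} → x ≢ y → x - y ≢ 0#
  x≢y⇒x-y≢0 x≢y x-y≡0 = x≢y (x-y≡0⇒x≡y x-y≡0)

  1≢0 : 1# ≢ 0#
  1≢0 1≡0 = 0≢1 (sym 1≡0)

  -- A total inverse, with the junk value 0# ⁻¹ = 0#.
  _⁻¹ : K → K
  x ⁻¹ with x ≟ 0#
  ... | yes _   = 0#
  ... | no x≢0 = proj₁ (inverse x x≢0)

  0⁻¹≡0 : 0# ⁻¹ ≡ 0#
  0⁻¹≡0 with 0# ≟ 0#
  ... | yes _  = refl
  ... | no 0≢0 = ⊥-elim (0≢0 refl)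

  x*x⁻¹≡1 : ∀ {x} → x ≢ 0# → x * x ⁻¹ ≡ 1#
  x*x⁻¹≡1 {x} x≢0 with x ≟ 0#
  ... | yes x≡0  = ⊥-elim (x≢0 x≡0)
  ... | no x≢0′ = proj₂ (inverse x x≢0′)

  x⁻¹*x≡1 : ∀ {x} → x ≢ 0# → x ⁻¹ * x ≡ 1#
  x⁻¹*x≡1 x≢0 = trans (*-comm _ _) (x*x⁻¹≡1 x≢0)

  x⁻¹*[x*y]≡y : ∀ {x} y → x ≢ 0# → x ⁻¹ * (x * y) ≡ y
  x⁻¹*[x*y]≡y {x} y x≢0 = begin
    x ⁻¹ * (x * y)   ≡⟨ *-assoc (x ⁻¹) x y ⟨
    (x ⁻¹ * x) * y   ≡⟨ cong (_* y) (x⁻¹*x≡1 x≢0) ⟩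
    1# * y           ≡⟨ *-identityˡ y ⟩
    y                ∎
    where open ≡-Reasoning

  x*[x⁻¹*y]≡y : ∀ {x} y → x ≢ 0# → x * (x ⁻¹ * y) ≡ y
  x*[x⁻¹*y]≡y {x} y x≢0 = trans (sym (*-assoc x (x ⁻¹) y)) (trans (cong (_* y) (x*x⁻¹≡1 x≢0)) (*-identityˡ y))

  *-cancelˡ : ∀ {x y z} → x ≢ 0# → x * y ≡ x * z → y ≡ z
  *-cancelˡ {x} {y} {z} x≢0 xy≡xz = begin
    y                ≡⟨ x⁻¹*[x*y]≡y y x≢0 ⟨
    x ⁻¹ * (x * y)   ≡⟨ cong (x ⁻¹ *_) xy≡xz ⟩
    x ⁻¹ * (x * z)   ≡⟨ x⁻¹*[x*y]≡y z x≢0 ⟩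
    z                ∎
    where open ≡-Reasoning

  x*y≡0⇒y≡0 : ∀ {x y} → x ≢ 0# → x * y ≡ 0# → y ≡ 0#
  x*y≡0⇒y≡0 {x} x≢0 xy≡0 = *-cancelˡ x≢0 (trans xy≡0 (sym (zeroʳ x)))

  *-nonzero : ∀ {x y} → x ≢ 0# → y ≢ 0# → x * y ≢ 0#
  *-nonzero x≢0 y≢0 xy≡0 = y≢0 (x*y≡0⇒y≡0 x≢0 xy≡0)

  ⁻¹-nonzero : ∀ {x} → x ≢ 0# → x ⁻¹ ≢ 0#
  ⁻¹-nonzero {x} x≢0 x⁻¹≡0 = 1≢0 (begin
    1#         ≡⟨ x*x⁻¹≡1 x≢0 ⟨
    x * x ⁻¹   ≡⟨ cong (x *_) x⁻¹≡0 ⟩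
    x * 0#     ≡⟨ zeroʳ x ⟩
    0#         ∎)
    where open ≡-Reasoning

  zero-product : ∀ {x y} → x * y ≡ 0# → x ≡ 0# ⊎ y ≡ 0#
  zero-product {x} {y} xy≡0 with x ≟ 0# | y ≟ 0#
  ... | yes x≡0 | _       = inj₁ x≡0
  ... | no _    | yes y≡0 = inj₂ y≡0
  ... | no x≢0  | no y≢0  = ⊥-elim (*-nonzero x≢0 y≢0 xy≡0)

  ^-+ : ∀ x m n → x ^ (m ℕ.+ n) ≡ x ^ m * x ^ n
  ^-+ x zero    n = sym (*-identityˡ _)
  ^-+ x (suc m) n = trans (cong (x *_) (^-+ x m n)) (sym (*-assoc _ _ _))

  ^-* : ∀ x m n → x ^ (m ℕ.* n) ≡ (x ^ n) ^ m
  ^-* x zero    n = refl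
  ^-* x (suc m) n = trans (^-+ x n (m ℕ.* n)) (cong (x ^ n *_) (^-* x m n))

  *-^ : ∀ x y n → (x * y) ^ n ≡ x ^ n * y ^ n
  *-^ x y zero    = sym (*-identityˡ _)
  *-^ x y (suc n) = trans (cong ((x * y) *_) (*-^ x y n))
    (solve 4 (λ x y a b → (x :* y) :* (a :* b) := (x :* a) :* (y :* b)) refl x y (x ^ n) (y ^ n))

  1^n≡1 : ∀ n → 1# ^ n ≡ 1#
  1^n≡1 zero    = refl
  1^n≡1 (suc n) = trans (*-identityˡ _) (1^n≡1 n)

  ^-nonzero : ∀ {x} n → x ≢ 0# → x ^ n ≢ 0#
  ^-nonzero zero    x≢0 = 1≢0
  ^-nonzero (suc n) x≢0 = *-nonzero x≢0 (^-nonzero n x≢0)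

  x^n≡0⇒x≡0 : ∀ {x} n → x ^ n ≡ 0# → x ≡ 0#
  x^n≡0⇒x≡0 {x} n x^n≡0 with x ≟ 0#
  ... | yes x≡0 = x≡0
  ... | no x≢0  = ⊥-elim (^-nonzero n x≢0 x^n≡0)

  enumerate : Fin q → K
  enumerate = Inverse.to card

  module FiniteSums {_∙_ : Op₂ K} {ε : K} (isCommutativeMonoid : IsCommutativeMonoid _≡_ _∙_ ε) where
    open IsCommutativeMonoid isCommutativeMonoid using (identityʳ)

    commutativeMonoid : CommutativeMonoid 0ℓ 0ℓ
    commutativeMonoid = record { isCommutativeMonoid = isCommutativeMonoid }

    open Algebra.Properties.CommutativeMonoid.Sum commutativeMonoid
      public using (sum; sum-cong-≗; ∑-distrib-+; sum-replicate; sum-replicate-zero; sum-init-last)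
    open Algebra.Properties.CommutativeMonoid.Sum commutativeMonoid using (sum-permute; sum-remove)

    sum-single : ∀ {n} (f : Fin n → K) i → (∀ j → j ≢ i → f j ≡ ε) → sum f ≡ f i
    sum-single {suc n} f i f≡ε = begin
      sum f                                ≡⟨ sum-remove {i = i} f ⟩
      f i ∙ sum (removeAt f i)             ≡⟨ cong (f i ∙_) (sum-cong-≗ λ j → f≡ε (punchIn i j) (Finₚ.punchInᵢ≢i i j)) ⟩
      f i ∙ sum {n} (λ _ → ε)              ≡⟨ cong (f i ∙_) (sum-replicate-zero n) ⟩
      f i ∙ ε                              ≡⟨ identityʳ (f i) ⟩
      f i                                  ∎
      where open ≡-Reasoning

    sum-bijection : ∀ (φ ψ : K → K) → (∀ x → φ (ψ x) ≡ x) → (∀ x → ψ (φ x) ≡ x) →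
                    ∀ h → sum {q} (h ∘ enumerate) ≡ sum {q} (h ∘ φ ∘ enumerate)
    sum-bijection φ ψ φψ ψφ h = trans (sum-permute (h ∘ enumerate) π)
      (sum-cong-≗ (λ i → cong h (Inverse.strictlyInverseˡ card (φ (enumerate i)))))
      where π = ↔-trans card (↔-trans (mk↔ₛ′ φ ψ φψ ψφ) (↔-sym card))

  private
    module Σ = FiniteSums +-isCommutativeMonoid
    module Π = FiniteSums *-isCommutativeMonoid

  -- Translation by y permutes F, so the sum of all elements satisfies Σ = Σ + q · y.
  q·x≡0 : ∀ y → q · y ≡ 0#
  q·x≡0 y = begin
    q · y                    ≡⟨ Σ.sum-replicate q ⟨
    Σ.sum {q} (λ _ → y)      ≡⟨ solve 2 (λ s t → t := (s :+ t) :- s) refl Σt _ ⟩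
    (Σt + Σ.sum {q} (λ _ → y)) - Σt
      ≡⟨ cong (_- Σt) (Σ.∑-distrib-+ enumerate (λ _ → y)) ⟨
    Σ.sum {q} (λ i → enumerate i + y) - Σt
      ≡⟨ cong (_- Σt) (Σ.sum-bijection (_+ y) (_- y) (λ x → solve 2 (λ x y → (x :- y) :+ y := x) refl x y)
                                           (λ x → solve 2 (λ x y → (x :+ y) :- y := x) refl x y) (λ t → t)) ⟨
    Σt - Σt                  ≡⟨ -‿inverseʳ Σt ⟩
    0#                       ∎
    where
    open ≡-Reasoning
    Σt = Σ.sum {q} enumerate

  ∏-nonzero : ∀ {n} (f : Fin n → K) → (∀ i → f i ≢ 0#) → Π.sum f ≢ 0#
  ∏-nonzero {zero}  f f≢0 = 1≢0
  ∏-nonzero {suc n} f f≢0 = *-nonzero (f≢0 Fin.zero) (∏-nonzero (f ∘ Fin.suc) (f≢0 ∘ Fin.suc))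

  ∏-const : ∀ n y → Π.sum {n} (λ _ → y) ≡ y ^ n
  ∏-const zero    y = refl
  ∏-const (suc n) y = cong (y *_) (∏-const n y)

  nonzeroPart : K → K
  nonzeroPart t with t ≟ 0#
  ... | yes _ = 1#
  ... | no _  = t

  nonzeroPart≢0 : ∀ t → nonzeroPart t ≢ 0#
  nonzeroPart≢0 t with t ≟ 0#
  ... | yes _  = 1≢0
  ... | no t≢0 = t≢0

  zeroCorrection : K → K → K
  zeroCorrection y t with t ≟ 0#
  ... | yes _ = y
  ... | no _  = 1#

  nonzeroPart-* : ∀ {y} → y ≢ 0# → ∀ t → nonzeroPart (y * t) * zeroCorrection y t ≡ y * nonzeroPart t
  nonzeroPart-* {y} y≢0 t with t ≟ 0# | y * t ≟ 0#
  ... | yes _   | yes _    = trans (*-identityˡ y) (sym (*-identityʳ y))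
  ... | yes t≡0 | no yt≢0  = ⊥-elim (yt≢0 (trans (cong (y *_) t≡0) (zeroʳ y)))
  ... | no t≢0  | yes yt≡0 = ⊥-elim (*-nonzero y≢0 t≢0 yt≡0)
  ... | no _    | no _     = *-identityʳ _

  ∏-zeroCorrection : ∀ y → Π.sum {q} (zeroCorrection y ∘ enumerate) ≡ y
  ∏-zeroCorrection y = trans (Π.sum-single _ 0ᵢ corr≡1) corr0
    where
    0ᵢ = Inverse.from card 0#
    corr≡1 : ∀ j → j ≢ 0ᵢ → zeroCorrection y (enumerate j) ≡ 1#
    corr≡1 j j≢0ᵢ with enumerate j ≟ 0#
    ... | yes eⱼ≡0 = ⊥-elim (j≢0ᵢ (trans (sym (Inverse.strictlyInverseʳ card j)) (cong (Inverse.from card) eⱼ≡0)))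
    ... | no _     = refl
    corr0 : zeroCorrection y (enumerate 0ᵢ) ≡ y
    corr0 with enumerate 0ᵢ ≟ 0#
    ... | yes _     = refl
    ... | no e₀≢0 = ⊥-elim (e₀≢0 (Inverse.strictlyInverseˡ card 0#))

  -- Multiplication by y ≢ 0# permutes F. Comparing the products P of nonzeroPart over t and over y * t
  -- gives P * y = P * y ^ q, where the factor y is the discrepancy at t = 0.
  x^q≡x : ∀ y → y ^ q ≡ y
  x^q≡x y with y ≟ 0#
  ... | yes refl = 0^q≡0 q (Inverse.from card 0#)
    where
    0^q≡0 : ∀ n → Fin n → 0# ^ n ≡ 0#
    0^q≡0 (suc n) _ = zeroˡ _
  ... | no y≢0 = sym (*-cancelˡ (∏-nonzero _ (nonzeroPart≢0 ∘ enumerate)) (begin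
    P * y                                                ≡⟨ cong (P *_) (∏-zeroCorrection y) ⟨
    P * E                                                ≡⟨ cong (_* E) (Π.sum-bijection (y *_) (y ⁻¹ *_)
                                                              (λ x → x*[x⁻¹*y]≡y x y≢0) (λ x → x⁻¹*[x*y]≡y x y≢0) nonzeroPart) ⟩
    Π.sum {q} (λ i → nonzeroPart (y * enumerate i)) * E  ≡⟨ Π.∑-distrib-+ {q} _ _ ⟨
    Π.sum {q} (λ i → nonzeroPart (y * enumerate i) * zeroCorrection y (enumerate i))
                                                         ≡⟨ Π.sum-cong-≗ (nonzeroPart-* y≢0 ∘ enumerate) ⟩
    Π.sum {q} (λ i → y * nonzeroPart (enumerate i))      ≡⟨ Π.∑-distrib-+ {q} _ _ ⟩
    Π.sum {q} (λ _ → y) * P                              ≡⟨ cong (_* P) (∏-const q y) ⟩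
    y ^ q * P                                            ≡⟨ *-comm _ _ ⟩
    P * y ^ q                                            ∎))
    where
    open ≡-Reasoning
    P = Π.sum {q} (nonzeroPart ∘ enumerate)
    E = Π.sum {q} (zeroCorrection y ∘ enumerate)

  fixedPoint : K → K → K
  fixedPoint γ δ = δ * (1# - γ) ⁻¹

  fixedPoint-fixed : ∀ {γ δ} → γ ≢ 1# → γ * fixedPoint γ δ + δ ≡ fixedPoint γ δ
  fixedPoint-fixed {γ} {δ} γ≢1 = begin
    γ * φ + δ
      ≡⟨ cong (γ * φ +_) (trans (cong (δ *_) (x⁻¹*x≡1 (x≢y⇒x-y≢0 (γ≢1 ∘ sym)))) (*-identityʳ δ)) ⟨
    γ * φ + δ * ((1# - γ) ⁻¹ * (1# - γ))
      ≡⟨ solve 3 (λ γ δ i → γ :* (δ :* i) :+ δ :* (i :* (:1 :- γ)) := δ :* i) refl γ δ ((1# - γ) ⁻¹) ⟩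
    φ ∎
    where
    open ≡-Reasoning
    φ = fixedPoint γ δ

  δ≡μ-γμ : ∀ {γ δ μ} → γ * μ + δ ≡ μ → δ ≡ μ - γ * μ
  δ≡μ-γμ {γ} {δ} {μ} fixed = trans (solve 2 (λ a δ → δ := (a :+ δ) :- a) refl (γ * μ) δ) (cong (_- γ * μ) fixed)

  private
    module Binomial = Algebra.Properties.CommutativeSemiring.Binomial commutativeSemiring
    open Algebra.Properties.Semiring.Exp semiring using () renaming (_^_ to _^ˢ_)

  ^≡binomial-^ : ∀ x n → x ^ n ≡ x ^ˢ n
  ^≡binomial-^ x zero    = refl
  ^≡binomial-^ x (suc n) = cong (x *_) (^≡binomial-^ x n)

  [x+y]^n≡x^n+y^n : ∀ n → .{{ℕ.NonZero n}} → (∀ {j} z → 0 ℕ.< j → j ℕ.< n → (n choose j) · z ≡ 0#) →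
                    ∀ x y → (x + y) ^ n ≡ x ^ n + y ^ n
  [x+y]^n≡x^n+y^n (suc n) middle≡0 x y = begin
    (x + y) ^ suc n                               ≡⟨ ^≡binomial-^ (x + y) (suc n) ⟩
    (x + y) ^ˢ suc n                              ≡⟨ Binomial.theorem (suc n) x y ⟩
    t Fin.zero + Σ.sum (t ∘ Fin.suc)              ≡⟨ cong (t Fin.zero +_) (Σ.sum-init-last (t ∘ Fin.suc)) ⟩
    t Fin.zero + (Σ.sum (t ∘ Fin.suc ∘ Fin.inject₁) + t (Fin.suc (Fin.fromℕ n)))
      ≡⟨ cong₂ (λ a b → t Fin.zero + (a + b)) (trans (Σ.sum-cong-≗ middle) (Σ.sum-replicate-zero n)) last ⟩
    t Fin.zero + (0# + x ^ suc n)                 ≡⟨ cong₂ _+_ first (+-identityˡ _) ⟩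
    y ^ suc n + x ^ suc n                         ≡⟨ +-comm _ _ ⟩
    x ^ suc n + y ^ suc n                         ∎
    where
    open ≡-Reasoning
    t = Binomial.binomialTerm x y (suc n)
    middle : ∀ i → t (Fin.suc (Fin.inject₁ i)) ≡ 0#
    middle i = middle≡0 _ (ℕ.s≤s ℕ.z≤n)
      (ℕ.s≤s (ℕ.≤-trans (ℕ.≤-reflexive (cong suc (Finₚ.toℕ-inject₁ i))) (Finₚ.toℕ<n i)))
    first : t Fin.zero ≡ y ^ suc n
    first = trans (+-identityʳ _) (trans (*-identityˡ _) (sym (^≡binomial-^ y (suc n))))
    last : t (Fin.suc (Fin.fromℕ n)) ≡ x ^ suc n
    last = lastTerm (cong suc (Finₚ.toℕ-fromℕ n))
      where
      lastTerm : ∀ {m} → m ≡ suc n → (suc n choose m) · (x ^ˢ m * y ^ˢ (suc n ∸ m)) ≡ x ^ suc n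
      lastTerm refl rewrite nCn≡1 (suc n) | ℕ.n∸n≡0 n =
        trans (+-identityʳ _) (trans (*-identityʳ _) (sym (^≡binomial-^ x (suc n))))


-- The subfield 𝔽ᵣ of 𝔽_{r²}

module Frobenius {p k r : ℕ} (p-prime : Prime p) (r≡p^[1+k] : r ≡ p ℕ.^ suc k)
                 (F : FiniteField (r ℕ.* r)) where
  open FieldProperties F public
  open Net {r} F public using (InFr; InFr*)

  fromℕ-^ : ∀ m n → fromℕ (m ℕ.^ n) ≡ fromℕ m ^ n
  fromℕ-^ m zero    = refl
  fromℕ-^ m (suc n) = trans (·′1-homo-* m (m ℕ.^ n)) (cong (fromℕ m *_) (fromℕ-^ m n))

  p·1≡0 : fromℕ p ≡ 0#
  p·1≡0 = x^n≡0⇒x≡0 (suc k) (begin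
    fromℕ p ^ suc k        ≡⟨ fromℕ-^ p (suc k) ⟨
    fromℕ (p ℕ.^ suc k)    ≡⟨ cong fromℕ r≡p^[1+k] ⟨
    fromℕ r                ≡⟨ reduce (zero-product r·1*r·1≡0) ⟩
    0#                     ∎)
    where
    open ≡-Reasoning
    r·1*r·1≡0 : fromℕ r * fromℕ r ≡ 0#
    r·1*r·1≡0 = trans (sym (·′1-homo-* r r)) (trans (sym (·1≡fromℕ (r ℕ.* r))) (q·x≡0 1#))

  p·x≡0 : ∀ z → p · z ≡ 0#
  p·x≡0 z = begin
    p · z              ≡⟨ cong (p ·_) (*-identityˡ z) ⟨
    p · (1# * z)       ≡⟨ ×-assoc-* p 1# z ⟨
    p · 1# * z         ≡⟨ cong (_* z) (trans (·1≡fromℕ p) p·1≡0) ⟩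
    0# * z             ≡⟨ zeroˡ z ⟩
    0#                 ∎
    where open ≡-Reasoning

  [x+y]^p≡x^p+y^p : ∀ x y → (x + y) ^ p ≡ x ^ p + y ^ p
  [x+y]^p≡x^p+y^p = [x+y]^n≡x^n+y^n p {{prime⇒nonZero p-prime}} middle≡0
    where
    middle≡0 : ∀ {j} z → 0 ℕ.< j → j ℕ.< p → (p choose j) · z ≡ 0#
    middle≡0 {j} z 0<j j<p with prime∣pCj p-prime 0<j j<p
    ... | divides c pCj≡c*p = begin
      (p choose j) · z   ≡⟨ cong (_· z) (trans pCj≡c*p (ℕ.*-comm c p)) ⟩
      (p ℕ.* c) · z      ≡⟨ ×-assocˡ z p c ⟨
      p · (c · z)        ≡⟨ p·x≡0 (c · z) ⟩
      0#                 ∎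
      where open ≡-Reasoning

  [x+y]^[p^n]≡x^[p^n]+y^[p^n] : ∀ n x y → (x + y) ^ (p ℕ.^ n) ≡ x ^ (p ℕ.^ n) + y ^ (p ℕ.^ n)
  [x+y]^[p^n]≡x^[p^n]+y^[p^n] zero    x y =
    trans (*-identityʳ _) (sym (cong₂ _+_ (*-identityʳ x) (*-identityʳ y)))
  [x+y]^[p^n]≡x^[p^n]+y^[p^n] (suc n) x y = begin
    (x + y) ^ (p ℕ.* p ℕ.^ n)                  ≡⟨ ^-* (x + y) p (p ℕ.^ n) ⟩
    ((x + y) ^ (p ℕ.^ n)) ^ p                  ≡⟨ cong (_^ p) ([x+y]^[p^n]≡x^[p^n]+y^[p^n] n x y) ⟩
    (x ^ (p ℕ.^ n) + y ^ (p ℕ.^ n)) ^ p        ≡⟨ [x+y]^p≡x^p+y^p _ _ ⟩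
    (x ^ (p ℕ.^ n)) ^ p + (y ^ (p ℕ.^ n)) ^ p  ≡⟨ cong₂ _+_ (^-* x p (p ℕ.^ n)) (^-* y p (p ℕ.^ n)) ⟨
    x ^ (p ℕ.* p ℕ.^ n) + y ^ (p ℕ.* p ℕ.^ n)  ∎
    where open ≡-Reasoning

  [x+y]^r≡x^r+y^r : ∀ x y → (x + y) ^ r ≡ x ^ r + y ^ r
  [x+y]^r≡x^r+y^r x y =
    subst (λ n → (x + y) ^ n ≡ x ^ n + y ^ n) (sym r≡p^[1+k]) ([x+y]^[p^n]≡x^[p^n]+y^[p^n] (suc k) x y)

  x^r^r≡x : ∀ x → (x ^ r) ^ r ≡ x
  x^r^r≡x x = trans (sym (^-* x r r)) (x^q≡x x)

  r≡2+[r∸2] : r ≡ suc (suc (r ∸ 2))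
  r≡2+[r∸2] = sym (ℕ.m+[n∸m]≡n 2≤r)
    where
    instance _ = prime⇒nonZero p-prime
    2≤r : 2 ℕ.≤ r
    2≤r = subst (2 ℕ.≤_) (sym r≡p^[1+k])
      (ℕ.≤-trans (ℕ.nonTrivial⇒n>1 p {{prime⇒nonTrivial p-prime}}) (ℕ.m≤m*n p (p ℕ.^ k) {{ℕ.m^n≢0 p k}}))

  0^r≡0 : 0# ^ r ≡ 0#
  0^r≡0 = subst (λ n → 0# ^ n ≡ 0#) (sym r≡2+[r∸2]) (zeroˡ _)

  [-x]^r≡-x^r : ∀ x → (- x) ^ r ≡ - (x ^ r)
  [-x]^r≡-x^r x = begin
    (- x) ^ r                       ≡⟨ solve 2 (λ a b → a := (a :+ b) :- b) refl ((- x) ^ r) (x ^ r) ⟩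
    ((- x) ^ r + x ^ r) - x ^ r     ≡⟨ cong (_- x ^ r) ([x+y]^r≡x^r+y^r (- x) x) ⟨
    (- x + x) ^ r - x ^ r           ≡⟨ cong (λ t → t ^ r - x ^ r) (-‿inverseˡ x) ⟩
    0# ^ r - x ^ r                  ≡⟨ cong (_- x ^ r) 0^r≡0 ⟩
    0# - x ^ r                      ≡⟨ +-identityˡ _ ⟩
    - (x ^ r)                       ∎
    where open ≡-Reasoning

  [x-y]^r≡x^r-y^r : ∀ x y → (x - y) ^ r ≡ x ^ r - y ^ r
  [x-y]^r≡x^r-y^r x y = trans ([x+y]^r≡x^r+y^r x (- y)) (cong (x ^ r +_) ([-x]^r≡-x^r y))

  InFr? : ∀ z → Dec (InFr z)
  InFr? z = z ^ r ≟ z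

  InFr-0 : InFr 0#
  InFr-0 = 0^r≡0

  InFr-1 : InFr 1#
  InFr-1 = 1^n≡1 r

  InFr-+ : ∀ {x y} → InFr x → InFr y → InFr (x + y)
  InFr-+ {x} {y} x∈ y∈ = trans ([x+y]^r≡x^r+y^r x y) (cong₂ _+_ x∈ y∈)

  InFr-* : ∀ {x y} → InFr x → InFr y → InFr (x * y)
  InFr-* {x} {y} x∈ y∈ = trans (*-^ x y r) (cong₂ _*_ x∈ y∈)

  InFr-neg : ∀ {x} → InFr x → InFr (- x)
  InFr-neg {x} x∈ = trans ([-x]^r≡-x^r x) (cong -_ x∈)

  InFr-- : ∀ {x y} → InFr x → InFr y → InFr (x - y)
  InFr-- {x} {y} x∈ y∈ = trans ([x-y]^r≡x^r-y^r x y) (cong₂ _-_ x∈ y∈)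

  InFr-⁻¹ : ∀ {x} → InFr x → InFr (x ⁻¹)
  InFr-⁻¹ {x} x∈ = byCases (x ≟ 0#)
    where
    open ≡-Reasoning
    byCases : Dec (x ≡ 0#) → InFr (x ⁻¹)
    byCases (yes x≡0) = subst (λ t → InFr (t ⁻¹)) (sym x≡0) (subst InFr (sym 0⁻¹≡0) InFr-0)
    byCases (no x≢0)  = *-cancelˡ x≢0 (begin
      x * (x ⁻¹) ^ r          ≡⟨ cong (_* (x ⁻¹) ^ r) x∈ ⟨
      x ^ r * (x ⁻¹) ^ r      ≡⟨ *-^ x (x ⁻¹) r ⟨
      (x * x ⁻¹) ^ r          ≡⟨ cong (_^ r) (x*x⁻¹≡1 x≢0) ⟩
      1# ^ r                  ≡⟨ 1^n≡1 r ⟩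
      1#                      ≡⟨ x*x⁻¹≡1 x≢0 ⟨
      x * x ⁻¹                ∎)

  InFr*-* : ∀ {x y} → InFr* x → InFr* y → InFr* (x * y)
  InFr*-* (x∈ , x≢0) (y∈ , y≢0) = InFr-* x∈ y∈ , *-nonzero x≢0 y≢0

  InFr*-⁻¹ : ∀ {x} → InFr* x → InFr* (x ⁻¹)
  InFr*-⁻¹ (x∈ , x≢0) = InFr-⁻¹ x∈ , ⁻¹-nonzero x≢0

  InFr*--1 : InFr* (- 1#)
  InFr*--1 = InFr-neg InFr-1 , λ -1≡0 → 1≢0 (trans (sym (-‿involutive 1#)) (trans (cong -_ -1≡0) -0#≈0#))

  x*x^[r∸2]≡1 : ∀ {x} → InFr* x → x * x ^ (r ∸ 2) ≡ 1#
  x*x^[r∸2]≡1 {x} (x∈ , x≢0) =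
    *-cancelˡ x≢0 (trans (subst (λ n → x ^ n ≡ x) r≡2+[r∸2] x∈) (sym (*-identityʳ x)))

  -- Raising V = α + β * w (α, β ∈ 𝔽ᵣ) to the power r gives V ^ r = α + β * w ^ r, whence β.
  module Basis (w : K) (w∉𝔽ᵣ : ¬ InFr w) where
    private
      D : K
      D = w - w ^ r

      D≢0 : D ≢ 0#
      D≢0 D≡0 = w∉𝔽ᵣ (sym (x-y≡0⇒x≡y D≡0))

      [D]^r≡-D : D ^ r ≡ - D
      [D]^r≡-D = begin
        (w - w ^ r) ^ r              ≡⟨ [x-y]^r≡x^r-y^r w (w ^ r) ⟩
        w ^ r - (w ^ r) ^ r          ≡⟨ cong (λ t → w ^ r - t) (x^r^r≡x w) ⟩
        w ^ r - w                    ≡⟨ solve 2 (λ a b → a :- b := :- (b :- a)) refl (w ^ r) w ⟩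
        - (w - w ^ r)                ∎
        where open ≡-Reasoning

    β : K → K
    β V = (V - V ^ r) * D ⁻¹

    α : K → K
    α V = V - β V * w

    β*D≡V-V^r : ∀ V → β V * D ≡ V - V ^ r
    β*D≡V-V^r V = trans (*-assoc _ _ _) (trans (cong ((V - V ^ r) *_) (x⁻¹*x≡1 D≢0)) (*-identityʳ _))

    β-InFr : ∀ V → InFr (β V)
    β-InFr V = *-cancelˡ D≢0 (begin
      D * β V ^ r                       ≡⟨ solve 2 (λ d b → d :* b := :- ((:- d) :* b)) refl D (β V ^ r) ⟩
      - (- D * β V ^ r)                 ≡⟨ cong (λ t → - (t * β V ^ r)) [D]^r≡-D ⟨
      - (D ^ r * β V ^ r)               ≡⟨ cong -_ (*-^ D (β V) r) ⟨
      - ((D * β V) ^ r)                 ≡⟨ cong (λ t → - (t ^ r)) (trans (*-comm D (β V)) (β*D≡V-V^r V)) ⟩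
      - ((V - V ^ r) ^ r)               ≡⟨ cong -_ ([x-y]^r≡x^r-y^r V (V ^ r)) ⟩
      - (V ^ r - (V ^ r) ^ r)           ≡⟨ cong (λ t → - (V ^ r - t)) (x^r^r≡x V) ⟩
      - (V ^ r - V)                     ≡⟨ solve 2 (λ a b → :- (a :- b) := b :- a) refl (V ^ r) V ⟩
      V - V ^ r                         ≡⟨ trans (*-comm D (β V)) (β*D≡V-V^r V) ⟨
      D * β V                           ∎)
      where open ≡-Reasoning

    α-InFr : ∀ V → InFr (α V)
    α-InFr V = begin
      (V - β V * w) ^ r                     ≡⟨ [x-y]^r≡x^r-y^r V (β V * w) ⟩
      V ^ r - (β V * w) ^ r                 ≡⟨ cong (λ t → V ^ r - t) (trans (*-^ (β V) w r) (cong (_* w ^ r) (β-InFr V))) ⟩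
      V ^ r - β V * w ^ r                   ≡⟨ solve 4 (λ V Vʳ b wʳ → Vʳ :- b :* wʳ := V :- b :* wʳ :- (V :- Vʳ))
                                                 refl V (V ^ r) (β V) (w ^ r) ⟩
      V - β V * w ^ r - (V - V ^ r)         ≡⟨ cong (λ t → V - β V * w ^ r - t) (β*D≡V-V^r V) ⟨
      V - β V * w ^ r - β V * (w - w ^ r)   ≡⟨ solve 4 (λ V b w wʳ → V :- b :* wʳ :- b :* (w :- wʳ) := V :- b :* w)
                                                 refl V (β V) w (w ^ r) ⟩
      V - β V * w                           ∎
      where open ≡-Reasoning

    α+βw≡id : ∀ V → α V + β V * w ≡ V
    α+βw≡id V = solve 2 (λ V t → (V :- t) :+ t := V) refl V (β V * w)

    basis-unique : ∀ {a b a′ b′} → InFr a → InFr b → InFr a′ → InFr b′ →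
                   a + b * w ≡ a′ + b′ * w → a ≡ a′ × b ≡ b′
    basis-unique {a} {b} {a′} {b′} a∈ b∈ a′∈ b′∈ eq with b ≟ b′
    ... | yes refl = (begin
      a                        ≡⟨ solve 2 (λ a t → a := (a :+ t) :- t) refl a (b * w) ⟩
      (a + b * w) - b * w      ≡⟨ cong (_- b * w) eq ⟩
      (a′ + b * w) - b * w     ≡⟨ solve 2 (λ a t → (a :+ t) :- t := a) refl a′ (b * w) ⟩
      a′                       ∎) , refl
      where open ≡-Reasoning
    ... | no b≢b′ = ⊥-elim (w∉𝔽ᵣ (subst InFr w≡ (InFr-* (InFr-- a′∈ a∈) (InFr-⁻¹ (InFr-- b∈ b′∈)))))
      where
      open ≡-Reasoning
      [b-b′]w≡a′-a : (b - b′) * w ≡ a′ - a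
      [b-b′]w≡a′-a = begin
        (b - b′) * w                               ≡⟨ solve 5 (λ a b a′ b′ w → (b :- b′) :* w := ((a :+ b :* w) :- (a′ :+ b′ :* w)) :+ (a′ :- a))
                                                        refl a b a′ b′ w ⟩
        (a + b * w) - (a′ + b′ * w) + (a′ - a)      ≡⟨ cong (λ t → t - (a′ + b′ * w) + (a′ - a)) eq ⟩
        (a′ + b′ * w) - (a′ + b′ * w) + (a′ - a)    ≡⟨ solve 2 (λ t u → t :- t :+ u := u) refl (a′ + b′ * w) (a′ - a) ⟩
        a′ - a                                      ∎
      w≡ : (a′ - a) * (b - b′) ⁻¹ ≡ w
      w≡ = begin
        (a′ - a) * (b - b′) ⁻¹              ≡⟨ cong (_* (b - b′) ⁻¹) [b-b′]w≡a′-a ⟨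
        ((b - b′) * w) * (b - b′) ⁻¹        ≡⟨ *-comm _ _ ⟩
        (b - b′) ⁻¹ * ((b - b′) * w)        ≡⟨ x⁻¹*[x*y]≡y w (x≢y⇒x-y≢0 b≢b′) ⟩
        w                                   ∎

  -- The pair γ δ stands for the affine map l ↦ γ * l + δ.
  module AffineAction (A : K → Set) where

    Preserves : K → K → Set
    Preserves γ δ = ∀ l → A l → A (γ * l + δ)

    Reflects : K → K → Set
    Reflects γ δ = ∀ ν → A (γ * ν + δ) → A ν

    Period : K → Set
    Period s = ∀ l → A l → A (l + s)

    TranslationOrFixing : K → K → Set
    TranslationOrFixing γ δ = γ ≡ 1# ⊎ ∃ λ μ → A μ × γ * μ + δ ≡ μ

    Preserves-∘ : ∀ {γ₁ δ₁ γ₂ δ₂} → Preserves γ₁ δ₁ → Preserves γ₂ δ₂ →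
                  Preserves (γ₁ * γ₂) (γ₁ * δ₂ + δ₁)
    Preserves-∘ {γ₁} {δ₁} {γ₂} {δ₂} f₁ f₂ l l∈A = subst A
      (solve 5 (λ γ₁ δ₁ γ₂ δ₂ l → γ₁ :* (γ₂ :* l :+ δ₂) :+ δ₁ := γ₁ :* γ₂ :* l :+ (γ₁ :* δ₂ :+ δ₁))
             refl γ₁ δ₁ γ₂ δ₂ l)
      (f₁ _ (f₂ l l∈A))

    Period-+ : ∀ {s t} → Period s → Period t → Period (s + t)
    Period-+ {s} {t} τₛ τₜ l l∈A = subst A (+-assoc l s t) (τₜ _ (τₛ l l∈A))

    Period-· : ∀ {s} → Period s → ∀ n → Period (n · s)
    Period-· τ zero    l l∈A = subst A (sym (+-identityʳ l)) l∈A
    Period-· {s} τ (suc n) l l∈A = subst A (solve 3 (λ l s t → (l :+ t) :+ s := l :+ (s :+ t)) refl l s (n · s))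
      (τ _ (Period-· τ n l l∈A))

    -- Since p · s ≡ 0#, the inverse translation is translation by (p - 1) · s.
    Period-neg : ∀ {s} → Period s → Period (- s)
    Period-neg {s} τ = subst Period [p-1]·s≡-s (Period-· τ (ℕ.pred p))
      where
      [p-1]·s≡-s : ℕ.pred p · s ≡ - s
      [p-1]·s≡-s = begin
        ℕ.pred p · s                        ≡⟨ solve 2 (λ s t → t := (s :+ t) :+ :- s) refl s (ℕ.pred p · s) ⟩
        (s + ℕ.pred p · s) - s              ≡⟨⟩
        suc (ℕ.pred p) · s - s              ≡⟨ cong (λ n → n · s - s) (ℕ.suc-pred p {{prime⇒nonZero p-prime}}) ⟩
        p · s - s                           ≡⟨ cong (_- s) (p·x≡0 s) ⟩
        0# - s                              ≡⟨ +-identityˡ (- s) ⟩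
        - s                                 ∎
        where open ≡-Reasoning

    -- The map has finite order: p if γ ≡ 1#, and dividing r - 1 otherwise; so its inverse is a power of it.
    preserves⇒reflects : ∀ {γ δ} → InFr* γ → Preserves γ δ → Reflects γ δ
    preserves⇒reflects {γ} {δ} γ∈ f with γ ≟ 1#
    ... | yes refl = λ ν ν+δ∈A → subst A (solve 2 (λ ν δ → :1 :* ν :+ δ :+ :- δ := ν) refl ν δ)
                                         (Period-neg translation _ ν+δ∈A)
      where
      translation : Period δ
      translation l l∈A = subst A (cong (_+ δ) (*-identityˡ l)) (f l l∈A)
    ... | no γ≢1 = λ ν fν∈A → subst A (fⁿ≡ν ν) (iterate (r ∸ 2) _ fν∈A)
      where
      open ≡-Reasoning
      φ = fixedPoint γ δ
      δ≡φ-γφ : δ ≡ φ - γ * φ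
      δ≡φ-γφ = δ≡μ-γμ (fixedPoint-fixed γ≢1)
      iterate : ∀ n l → A l → A (φ + γ ^ n * (l - φ))
      iterate zero    l l∈A = subst A (solve 2 (λ l φ → l := φ :+ :1 :* (l :- φ)) refl l φ) l∈A
      iterate (suc n) l l∈A = subst A (begin
        γ * (φ + γ ^ n * (l - φ)) + δ           ≡⟨ cong (γ * (φ + γ ^ n * (l - φ)) +_) δ≡φ-γφ ⟩
        γ * (φ + γ ^ n * (l - φ)) + (φ - γ * φ) ≡⟨ solve 4 (λ γ φ g l → γ :* (φ :+ g :* (l :- φ)) :+ (φ :- γ :* φ) := φ :+ (γ :* g) :* (l :- φ))
                                                    refl γ φ (γ ^ n) l ⟩
        φ + γ ^ suc n * (l - φ)                 ∎) (f _ (iterate n l l∈A))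
      fⁿ≡ν : ∀ ν → φ + γ ^ (r ∸ 2) * (γ * ν + δ - φ) ≡ ν
      fⁿ≡ν ν = begin
        φ + γ ^ (r ∸ 2) * (γ * ν + δ - φ)        ≡⟨ cong (λ t → φ + γ ^ (r ∸ 2) * (γ * ν + t - φ)) δ≡φ-γφ ⟩
        φ + γ ^ (r ∸ 2) * (γ * ν + (φ - γ * φ) - φ)
          ≡⟨ solve 4 (λ φ g γ ν → φ :+ g :* (γ :* ν :+ (φ :- γ :* φ) :- φ) := φ :+ (γ :* g) :* (ν :- φ))
                   refl φ (γ ^ (r ∸ 2)) γ ν ⟩
        φ + (γ * γ ^ (r ∸ 2)) * (ν - φ)          ≡⟨ cong (λ t → φ + t * (ν - φ)) (x*x^[r∸2]≡1 γ∈) ⟩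
        φ + 1# * (ν - φ)                         ≡⟨ solve 2 (λ φ ν → φ :+ :1 :* (ν :- φ) := ν) refl φ ν ⟩
        ν                                        ∎

    γ*[γ⁻¹*[l-δ]]+δ≡l : ∀ {γ} δ l → γ ≢ 0# → γ * (γ ⁻¹ * (l - δ)) + δ ≡ l
    γ*[γ⁻¹*[l-δ]]+δ≡l {γ} δ l γ≢0 = begin
      γ * (γ ⁻¹ * (l - δ)) + δ
        ≡⟨ solve 4 (λ γ i l δ → γ :* (i :* (l :- δ)) :+ δ := (γ :* i) :* (l :- δ) :+ δ) refl γ (γ ⁻¹) l δ ⟩
      (γ * γ ⁻¹) * (l - δ) + δ    ≡⟨ cong (λ t → t * (l - δ) + δ) (x*x⁻¹≡1 γ≢0) ⟩
      1# * (l - δ) + δ            ≡⟨ solve 2 (λ l δ → :1 :* (l :- δ) :+ δ := l) refl l δ ⟩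
      l                           ∎
      where open ≡-Reasoning

    reflects⇒inverse-preserves : ∀ {γ δ} → γ ≢ 0# → Reflects γ δ → Preserves (γ ⁻¹) (- (γ ⁻¹ * δ))
    reflects⇒inverse-preserves {γ} {δ} γ≢0 f⁻¹ l l∈A = f⁻¹ _ (subst A (sym (begin
      γ * (γ ⁻¹ * l + - (γ ⁻¹ * δ)) + δ
        ≡⟨ cong (λ t → γ * t + δ) (solve 3 (λ i l δ → i :* l :+ :- (i :* δ) := i :* (l :- δ)) refl (γ ⁻¹) l δ) ⟩
      γ * (γ ⁻¹ * (l - δ)) + δ           ≡⟨ γ*[γ⁻¹*[l-δ]]+δ≡l δ l γ≢0 ⟩
      l                                  ∎)) l∈A)
      where open ≡-Reasoning

    reflects⇒preserves : ∀ {γ δ} → InFr* γ → Reflects γ δ → Preserves γ δ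
    reflects⇒preserves {γ} {δ} γ∈@(_ , γ≢0) f⁻¹ μ μ∈A =
      preserves⇒reflects (InFr*-⁻¹ γ∈) (reflects⇒inverse-preserves γ≢0 f⁻¹) (γ * μ + δ) (subst A (sym f⁻¹∘f≡id) μ∈A)
      where
      f⁻¹∘f≡id : γ ⁻¹ * (γ * μ + δ) + - (γ ⁻¹ * δ) ≡ μ
      f⁻¹∘f≡id = trans (solve 4 (λ i γ μ δ → i :* (γ :* μ :+ δ) :+ :- (i :* δ) := i :* (γ :* μ)) refl (γ ⁻¹) γ μ δ)
                       (x⁻¹*[x*y]≡y μ γ≢0)

    -- Conjugating the translation by s with the map gives the translation by γ * s.
    Period-* : ∀ {γ δ s} → InFr* γ → Preserves γ δ → Period s → Period (γ * s)
    Period-* {γ} {δ} {s} γ∈@(_ , γ≢0) f τ l l∈A = subst A (begin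
      γ * (ν + s) + δ             ≡⟨ solve 4 (λ γ ν s δ → γ :* (ν :+ s) :+ δ := (γ :* ν :+ δ) :+ γ :* s) refl γ ν s δ ⟩
      (γ * ν + δ) + γ * s         ≡⟨ cong (_+ γ * s) (γ*[γ⁻¹*[l-δ]]+δ≡l δ l γ≢0) ⟩
      l + γ * s                   ∎) (f _ (τ ν ν∈A))
      where
      open ≡-Reasoning
      ν = γ ⁻¹ * (l - δ)
      ν∈A : A ν
      ν∈A = preserves⇒reflects γ∈ f ν (subst A (sym (γ*[γ⁻¹*[l-δ]]+δ≡l δ l γ≢0)) l∈A)

    -- (1 - γ)⁻¹ = (1 - γ) ^ (r - 2), and multiplying by 1 - γ preserves periods.
    Period-/[1-γ] : ∀ {γ δ s} → InFr* γ → Preserves γ δ → γ ≢ 1# → Period s → Period ((1# - γ) ⁻¹ * s)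
    Period-/[1-γ] {γ} {δ} {s} γ∈@(γ∈𝔽ᵣ , _) f γ≢1 τ = subst Period [1-γ]^[r-2]s≡[1-γ]⁻¹s (power (r ∸ 2))
      where
      open ≡-Reasoning
      u = 1# - γ
      u∈ : InFr* u
      u∈ = InFr-- InFr-1 γ∈𝔽ᵣ , x≢y⇒x-y≢0 (γ≢1 ∘ sym)
      power : ∀ n → Period (u ^ n * s)
      power zero    = subst Period (sym (*-identityˡ s)) τ
      power (suc n) = subst Period
        (solve 2 (λ t γ → t :+ :- (γ :* t) := (:1 :- γ) :* t) refl (u ^ n * s) γ ⟨ trans ⟩ sym (*-assoc u (u ^ n) s))
        (Period-+ (power n) (Period-neg (Period-* γ∈ f (power n))))
      [1-γ]^[r-2]s≡[1-γ]⁻¹s : u ^ (r ∸ 2) * s ≡ u ⁻¹ * s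
      [1-γ]^[r-2]s≡[1-γ]⁻¹s = cong (_* s) (*-cancelˡ (proj₂ u∈) (trans (x*x^[r∸2]≡1 u∈) (sym (x*x⁻¹≡1 (proj₂ u∈)))))

    -- The commutator of the two maps is the translation by (1 - γ₁) * ((1 - γ₂) * (μ₁ - μ₂)).
    fixedPoints-differ-by-Period : ∀ {γ₁ δ₁ γ₂ δ₂ μ₁ μ₂} →
      InFr* γ₁ → InFr* γ₂ → Preserves γ₁ δ₁ → Preserves γ₂ δ₂ → γ₁ ≢ 1# → γ₂ ≢ 1# →
      γ₁ * μ₁ + δ₁ ≡ μ₁ → γ₂ * μ₂ + δ₂ ≡ μ₂ → Period (μ₁ - μ₂)
    fixedPoints-differ-by-Period {γ₁} {δ₁} {γ₂} {δ₂} {μ₁} {μ₂} γ₁∈ γ₂∈ f₁ f₂ γ₁≢1 γ₂≢1 fix₁ fix₂ =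
      subst Period (x⁻¹*[x*y]≡y (μ₁ - μ₂) (x≢y⇒x-y≢0 (γ₂≢1 ∘ sym)))
        (Period-/[1-γ] γ₂∈ f₂ γ₂≢1
          (subst Period (x⁻¹*[x*y]≡y ((1# - γ₂) * (μ₁ - μ₂)) (x≢y⇒x-y≢0 (γ₁≢1 ∘ sym)))
            (Period-/[1-γ] γ₁∈ f₁ γ₁≢1 commutator)))
      where
      open ≡-Reasoning
      t = (1# - γ₁) * ((1# - γ₂) * (μ₁ - μ₂))
      commutator : Period t
      commutator l l∈A = subst A f₁f₂ν≡l+t (f₁ _ (f₂ ν ν∈A))
        where
        γ = γ₂ * γ₁
        δ = γ₂ * δ₁ + δ₂
        ν = γ ⁻¹ * (l - δ)
        f₂f₁ν≡l : γ * ν + δ ≡ l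
        f₂f₁ν≡l = γ*[γ⁻¹*[l-δ]]+δ≡l δ l (proj₂ (InFr*-* γ₂∈ γ₁∈))
        ν∈A : A ν
        ν∈A = preserves⇒reflects (InFr*-* γ₂∈ γ₁∈) (Preserves-∘ f₂ f₁) ν (subst A (sym f₂f₁ν≡l) l∈A)
        f₁f₂ν≡l+t : γ₁ * (γ₂ * ν + δ₂) + δ₁ ≡ l + t
        f₁f₂ν≡l+t = begin
          γ₁ * (γ₂ * ν + δ₂) + δ₁
            ≡⟨ cong₂ (λ a b → γ₁ * (γ₂ * ν + a) + b) (δ≡μ-γμ fix₂) (δ≡μ-γμ fix₁) ⟩
          γ₁ * (γ₂ * ν + (μ₂ - γ₂ * μ₂)) + (μ₁ - γ₁ * μ₁)
            ≡⟨ solve 5 (λ γ₁ γ₂ ν μ₁ μ₂ → γ₁ :* (γ₂ :* ν :+ (μ₂ :- γ₂ :* μ₂)) :+ (μ₁ :- γ₁ :* μ₁)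
                   := (γ₂ :* γ₁ :* ν :+ (γ₂ :* (μ₁ :- γ₁ :* μ₁) :+ (μ₂ :- γ₂ :* μ₂)))
                      :+ (:1 :- γ₁) :* ((:1 :- γ₂) :* (μ₁ :- μ₂)))
                 refl γ₁ γ₂ ν μ₁ μ₂ ⟩
          (γ * ν + (γ₂ * (μ₁ - γ₁ * μ₁) + (μ₂ - γ₂ * μ₂))) + t
            ≡⟨ cong₂ (λ a b → (γ * ν + (γ₂ * a + b)) + t) (δ≡μ-γμ fix₁) (δ≡μ-γμ fix₂) ⟨
          (γ * ν + δ) + t
            ≡⟨ cong (_+ t) f₂f₁ν≡l ⟩
          l + t ∎

    fixedPoint∈A : ∀ {γ δ γ′ δ′} → InFr* γ → Preserves γ δ → γ ≢ 1# →
                   InFr* γ′ → Preserves γ′ δ′ → γ′ ≢ 1# → TranslationOrFixing γ′ δ′ → A (fixedPoint γ δ)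
    fixedPoint∈A _  _ _   _   _  γ′≢1 (inj₁ γ′≡1)            = ⊥-elim (γ′≢1 γ′≡1)
    fixedPoint∈A γ∈ f γ≢1 γ′∈ f′ γ′≢1 (inj₂ (μ , μ∈A , fix)) =
      subst A (solve 2 (λ μ φ → μ :+ (φ :- μ) := φ) refl μ _) (fixedPoints-differ-by-Period γ∈ γ′∈ f f′ γ≢1 γ′≢1 (fixedPoint-fixed γ≢1) fix μ μ∈A)

    TranslationOrFixing-∘ : ∀ {γ₁ δ₁ γ₂ δ₂} → InFr* γ₁ → InFr* γ₂ → Preserves γ₁ δ₁ → Preserves γ₂ δ₂ →
                            TranslationOrFixing γ₁ δ₁ → TranslationOrFixing γ₂ δ₂ →
                            TranslationOrFixing (γ₁ * γ₂) (γ₁ * δ₂ + δ₁)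
    TranslationOrFixing-∘ {γ₁} {δ₁} {γ₂} {δ₂} γ₁∈ γ₂∈ f₁ f₂ tf₁ tf₂ with γ₁ * γ₂ ≟ 1#
    ... | yes γ≡1 = inj₁ γ≡1
    ... | no γ≢1  = inj₂ (_ , fixed∈A (γ₁ ≟ 1#) , fixedPoint-fixed γ≢1)
      where
      fixed∈A : Dec (γ₁ ≡ 1#) → A (fixedPoint (γ₁ * γ₂) (γ₁ * δ₂ + δ₁))
      fixed∈A (no γ₁≢1)  = fixedPoint∈A (InFr*-* γ₁∈ γ₂∈) (Preserves-∘ f₁ f₂) γ≢1 γ₁∈ f₁ γ₁≢1 tf₁
      fixed∈A (yes γ₁≡1) = fixedPoint∈A (InFr*-* γ₁∈ γ₂∈) (Preserves-∘ f₁ f₂) γ≢1 γ₂∈ f₂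
        (λ γ₂≡1 → γ≢1 (trans (cong₂ _*_ γ₁≡1 γ₂≡1) (*-identityˡ 1#))) tf₂

-- The net

module NetGeometry {p k r : ℕ} (p-prime : Prime p) (r≡p^[1+k] : r ≡ p ℕ.^ suc k)
                   (F : FiniteField (r ℕ.* r)) where
  open Frobenius {k = k} p-prime r≡p^[1+k] F
  open Net {r} F using (IsDirectionSet; OnLine; Adj; Perp; IsClique; IsMaximalClique; aff; Stabilizes)

  module _ {m S} (isDirectionSet : IsDirectionSet m S) where
    private
      d = proj₁ isDirectionSet
      d≢0 = proj₁ (proj₂ isDirectionSet)
      S⇔coset = proj₂ (proj₂ (proj₂ isDirectionSet))

    directionSet-nonzero : ∀ {z} → S z → z ≢ 0#
    directionSet-nonzero {z} z∈S z≡0 with proj₁ (S⇔coset z) z∈S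
    ... | i , c , (_ , c≢0) , z≡cdᵢ = *-nonzero c≢0 (d≢0 i) (trans (sym z≡cdᵢ) z≡0)

    directionSet-scale : ∀ {c z} → InFr* c → S z → S (c * z)
    directionSet-scale {c} {z} c∈ z∈S with proj₁ (S⇔coset z) z∈S
    ... | i , c′ , c′∈ , z≡c′dᵢ = proj₂ (S⇔coset (c * z))
      (i , c * c′ , InFr*-* c∈ c′∈ , trans (cong (c *_) z≡c′dᵢ) (sym (*-assoc c c′ (d i))))

  module OnNet (S : K → Set) (S-nonzero : ∀ {z} → S z → z ≢ 0#)
               (S-scale : ∀ {c z} → InFr* c → S z → S (c * z)) where

    Adj-sym : ∀ {y z} → Adj S y z → Adj S z y
    Adj-sym {y} {z} (y≢z , y-z∈S) = y≢z ∘ sym ,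
      subst S (solve 2 (λ y z → (:- :1) :* (y :- z) := z :- y) refl y z) (S-scale InFr*--1 y-z∈S)

    aff-Adj : ∀ {c e y z} → InFr* c → Adj S y z → Adj S (aff c e y) (aff c e z)
    aff-Adj {c} {e} {y} {z} c∈@(_ , c≢0) (y≢z , y-z∈S) = y≢z ∘ aff-injective ,
      subst S (solve 4 (λ c y z e → c :* (y :- z) := (c :* y :+ e) :- (c :* z :+ e)) refl c y z e) (S-scale c∈ y-z∈S)
      where
      aff-injective : aff c e y ≡ aff c e z → y ≡ z
      aff-injective eq = *-cancelˡ c≢0 (begin
        c * y                ≡⟨ solve 2 (λ a e → a := (a :+ e) :- e) refl (c * y) e ⟩
        (c * y + e) - e      ≡⟨ cong (_- e) eq ⟩
        (c * z + e) - e      ≡⟨ solve 2 (λ a e → (a :+ e) :- e := a) refl (c * z) e ⟩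
        c * z                ∎)
        where open ≡-Reasoning

    adjacent-to-all⇒∈ : ∀ {C z} → IsMaximalClique S C → (∀ y → C y → y ≢ z → Adj S z y) → C z
    adjacent-to-all⇒∈ {C} {z} (C-clique , C-maximal) z~C = C-maximal C+z C+z-clique (λ _ → inj₁) z (inj₂ refl)
      where
      C+z : K → Set
      C+z y = C y ⊎ y ≡ z
      C+z-clique : IsClique S C+z
      C+z-clique y y′ (inj₁ y∈C)  (inj₁ y′∈C) y≢y′ = C-clique y y′ y∈C y′∈C y≢y′
      C+z-clique y _  (inj₁ y∈C)  (inj₂ refl) y≢z  = Adj-sym (z~C y y∈C y≢z)
      C+z-clique _ y′ (inj₂ refl) (inj₁ y′∈C) z≢y′ = z~C y′ y′∈C (z≢y′ ∘ sym)
      C+z-clique _ _  (inj₂ refl) (inj₂ refl) z≢z  = ⊥-elim (z≢z refl)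

    module Coordinates (a d : K) (d∈S : S d) where
      private
        d≢0 : d ≢ 0#
        d≢0 = S-nonzero d∈S

      L : K → Set
      L = OnLine a d

      point : K → K
      point t = a + d * t

      coord : K → K
      coord z = (z - a) * d ⁻¹

      point-coord : ∀ z → point (coord z) ≡ z
      point-coord z = begin
        a + d * ((z - a) * d ⁻¹)
          ≡⟨ solve 4 (λ a d z i → a :+ d :* ((z :- a) :* i) := a :+ (d :* i) :* (z :- a)) refl a d z (d ⁻¹) ⟩
        a + (d * d ⁻¹) * (z - a)     ≡⟨ cong (λ t → a + t * (z - a)) (x*x⁻¹≡1 d≢0) ⟩
        a + 1# * (z - a)             ≡⟨ solve 2 (λ a z → a :+ :1 :* (z :- a) := z) refl a z ⟩
        z                            ∎
        where open ≡-Reasoning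

      coord-point : ∀ t → coord (point t) ≡ t
      coord-point t = begin
        ((a + d * t) - a) * d ⁻¹     ≡⟨ solve 4 (λ a d t i → ((a :+ d :* t) :- a) :* i := i :* (d :* t)) refl a d t (d ⁻¹) ⟩
        d ⁻¹ * (d * t)               ≡⟨ x⁻¹*[x*y]≡y t d≢0 ⟩
        t                            ∎
        where open ≡-Reasoning

      coord-injective : ∀ {y z} → coord y ≡ coord z → y ≡ z
      coord-injective {y} {z} eq = trans (sym (point-coord y)) (trans (cong point eq) (point-coord z))

      y-z≡d*[coord-y-coord-z] : ∀ y z → y - z ≡ d * (coord y - coord z)
      y-z≡d*[coord-y-coord-z] y z = begin
        y - z                                  ≡⟨ cong₂ _-_ (point-coord y) (point-coord z) ⟨
        point (coord y) - point (coord z)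
          ≡⟨ solve 4 (λ a d s t → (a :+ d :* s) :- (a :+ d :* t) := d :* (s :- t)) refl a d (coord y) (coord z) ⟩
        d * (coord y - coord z)                ∎
        where open ≡-Reasoning

      L⇒InFr : ∀ {z} → L z → InFr (coord z)
      L⇒InFr (t , t∈ , z≡a+dt) = subst InFr (sym (trans (cong coord z≡a+dt) (coord-point t))) t∈

      InFr⇒L : ∀ {z} → InFr (coord z) → L z
      InFr⇒L {z} z∈ = coord z , z∈ , sym (point-coord z)

      S′ : K → Set
      S′ t = S (d * t)

      S⇔S′ : ∀ {y z} → S (y - z) → S′ (coord y - coord z)
      S⇔S′ {y} {z} = subst S (y-z≡d*[coord-y-coord-z] y z)

      S′⇒S : ∀ {y z} → S′ (coord y - coord z) → S (y - z)
      S′⇒S {y} {z} = subst S (sym (y-z≡d*[coord-y-coord-z] y z))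

      S′-scale : ∀ {c t} → InFr* c → S′ t → S′ (c * t)
      S′-scale {c} {t} c∈ t∈S′ = subst S (solve 3 (λ c d t → c :* (d :* t) := d :* (c :* t)) refl c d t) (S-scale c∈ t∈S′)

      InFr*⇒S′ : ∀ {t} → InFr* t → S′ t
      InFr*⇒S′ {t} t∈ = subst S (*-comm t d) (S-scale t∈ d∈S)

      -- The net automorphism acting on coordinates as t ↦ c * t + e.
      liftAff : K → K → K → K
      liftAff c e = aff c (a + d * e - c * a)

      coord-liftAff : ∀ c e z → coord (liftAff c e z) ≡ c * coord z + e
      coord-liftAff c e z = begin
        coord (c * z + (a + d * e - c * a))                  ≡⟨ cong (λ t → coord (c * t + (a + d * e - c * a))) (point-coord z) ⟨
        coord (c * point (coord z) + (a + d * e - c * a))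
          ≡⟨ cong coord (solve 5 (λ c a d t e → c :* (a :+ d :* t) :+ (a :+ d :* e :- c :* a) := a :+ d :* (c :* t :+ e))
                                 refl c a d (coord z) e) ⟩
        coord (point (c * coord z + e))                      ≡⟨ coord-point _ ⟩
        c * coord z + e                                      ∎
        where open ≡-Reasoning

      liftAff-L : ∀ {c e z} → InFr* c → InFr e → L z → L (liftAff c e z)
      liftAff-L {c} {e} {z} (c∈ , _) e∈ z∈L =
        InFr⇒L (subst InFr (sym (coord-liftAff c e z)) (InFr-+ (InFr-* c∈ (L⇒InFr z∈L)) e∈))

      liftAff-L⁻¹ : ∀ {c e z} → InFr* c → InFr e → L (liftAff c e z) → L z
      liftAff-L⁻¹ {c} {e} {z} (c∈ , c≢0) e∈ gz∈L = InFr⇒L (subst InFr (begin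
        c ⁻¹ * (coord (liftAff c e z) - e)    ≡⟨ cong (λ t → c ⁻¹ * (t - e)) (coord-liftAff c e z) ⟩
        c ⁻¹ * (c * coord z + e - e)          ≡⟨ cong (c ⁻¹ *_) (solve 2 (λ t e → t :+ e :- e := t) refl (c * coord z) e) ⟩
        c ⁻¹ * (c * coord z)                  ≡⟨ x⁻¹*[x*y]≡y (coord z) c≢0 ⟩
        coord z                               ∎) (InFr-* (InFr-⁻¹ c∈) (InFr-- (L⇒InFr gz∈L) e∈)))
        where open ≡-Reasoning

      module OffLine (x : K) (x∉L : ¬ L x) where
        w : K
        w = coord x

        w∉𝔽ᵣ : ¬ InFr w
        w∉𝔽ᵣ = x∉L ∘ InFr⇒L

        private module B = Basis w w∉𝔽ᵣ

        α β : K → K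
        α z = B.α (coord z)
        β z = B.β (coord z)

        coord≡α+βw : ∀ z → coord z ≡ α z + β z * w
        coord≡α+βw z = sym (B.α+βw≡id (coord z))

        β∈𝔽ᵣ* : ∀ {z} → ¬ L z → InFr* (β z)
        β∈𝔽ᵣ* {z} z∉L = B.β-InFr (coord z) , λ βz≡0 → z∉L (InFr⇒L (subst InFr (sym (begin
          coord z            ≡⟨ coord≡α+βw z ⟩
          α z + β z * w      ≡⟨ cong (λ t → α z + t * w) βz≡0 ⟩
          α z + 0# * w       ≡⟨ solve 2 (λ a w → a :+ con (ℤ.+ 0) :* w := a) refl (α z) w ⟩
          α z                ∎)) (B.α-InFr (coord z))))
          where open ≡-Reasoning

        coord-y-coord-z : ∀ y z → coord y - coord z ≡ (α y - α z) + (β y - β z) * w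
        coord-y-coord-z y z = trans (cong₂ _-_ (coord≡α+βw y) (coord≡α+βw z))
          (solve 5 (λ a b a′ b′ w → (a :+ b :* w) :- (a′ :+ b′ :* w) := (a :- a′) :+ (b :- b′) :* w)
                   refl (α y) (β y) (α z) (β z) w)

        -- The points of L adjacent to x, in coordinates.
        A : K → Set
        A t = InFr t × S′ (w - t)

        S′⇒A : ∀ {a b} → InFr a → InFr* b → S′ (a + b * w) → A (- (b ⁻¹ * a))
        S′⇒A {a} {b} a∈ b∈@(_ , b≢0) a+bw∈S′ =
          InFr-neg (InFr-* (InFr-⁻¹ (proj₁ b∈)) a∈) , subst S′ b⁻¹[a+bw]≡w+b⁻¹a (S′-scale (InFr*-⁻¹ b∈) a+bw∈S′)
          where
          b⁻¹[a+bw]≡w+b⁻¹a : b ⁻¹ * (a + b * w) ≡ w - (- (b ⁻¹ * a))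
          b⁻¹[a+bw]≡w+b⁻¹a = begin
            b ⁻¹ * (a + b * w)
              ≡⟨ solve 4 (λ i a b w → i :* (a :+ b :* w) := i :* (b :* w) :- (:- (i :* a))) refl (b ⁻¹) a b w ⟩
            b ⁻¹ * (b * w) - (- (b ⁻¹ * a)) ≡⟨ cong (_- (- (b ⁻¹ * a))) (x⁻¹*[x*y]≡y w b≢0) ⟩
            w - (- (b ⁻¹ * a))         ∎
            where open ≡-Reasoning

        open AffineAction A public

        -- A point z off L gives the affine map h_z : μ ↦ β z * μ + α z of 𝔽ᵣ;
        -- relSlope y z and relShift y z encode h_z⁻¹ ∘ h_y.
        relSlope relShift : K → K → K
        relSlope y z = β z ⁻¹ * β y
        relShift y z = β z ⁻¹ * α y - β z ⁻¹ * α z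

        relative-map : ∀ {z} y → β z ≢ 0# → ∀ μ →
                       relSlope y z * μ + relShift y z ≡ μ + β z ⁻¹ * ((β y - β z) * μ + (α y - α z))
        relative-map {z} y βz≢0 μ = begin
          relSlope y z * μ + relShift y z
            ≡⟨ solve 6 (λ i b b′ a a′ μ → i :* b :* μ :+ (i :* a :- i :* a′)
                                         := (i :* b′ :- :1) :* μ :+ μ :+ i :* ((b :- b′) :* μ :+ (a :- a′)))
                 refl (β z ⁻¹) (β y) (β z) (α y) (α z) μ ⟩
          (β z ⁻¹ * β z - 1#) * μ + μ + β z ⁻¹ * ((β y - β z) * μ + (α y - α z))
            ≡⟨ cong (λ t → (t - 1#) * μ + μ + β z ⁻¹ * ((β y - β z) * μ + (α y - α z))) (x⁻¹*x≡1 βz≢0) ⟩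
          (1# - 1#) * μ + μ + β z ⁻¹ * ((β y - β z) * μ + (α y - α z))
            ≡⟨ solve 3 (λ μ X o → (o :- o) :* μ :+ μ :+ X := μ :+ X) refl μ (β z ⁻¹ * ((β y - β z) * μ + (α y - α z))) 1# ⟩
          μ + β z ⁻¹ * ((β y - β z) * μ + (α y - α z))   ∎
          where open ≡-Reasoning

        relative-fixed⇒ : ∀ {y z μ} → β z ≢ 0# → relSlope y z * μ + relShift y z ≡ μ →
                          (β y - β z) * μ + (α y - α z) ≡ 0#
        relative-fixed⇒ {y} {z} {μ} βz≢0 fixed = x*y≡0⇒y≡0 (⁻¹-nonzero βz≢0) (begin
          β z ⁻¹ * X               ≡⟨ solve 2 (λ μ t → t := (μ :+ t) :- μ) refl μ (β z ⁻¹ * X) ⟩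
          (μ + β z ⁻¹ * X) - μ     ≡⟨ cong (_- μ) (relative-map y βz≢0 μ) ⟨
          (relSlope y z * μ + relShift y z) - μ ≡⟨ cong (_- μ) fixed ⟩
          μ - μ                    ≡⟨ -‿inverseʳ μ ⟩
          0#                       ∎)
          where
          open ≡-Reasoning
          X = (β y - β z) * μ + (α y - α z)

        relative-fixed⇐ : ∀ {y z μ} → β z ≢ 0# → (β y - β z) * μ + (α y - α z) ≡ 0# →
                          relSlope y z * μ + relShift y z ≡ μ
        relative-fixed⇐ {y} {z} {μ} βz≢0 X≡0 = begin
          relSlope y z * μ + relShift y z                       ≡⟨ relative-map y βz≢0 μ ⟩
          μ + β z ⁻¹ * ((β y - β z) * μ + (α y - α z))          ≡⟨ cong (λ t → μ + β z ⁻¹ * t) X≡0 ⟩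
          μ + β z ⁻¹ * 0#                                       ≡⟨ cong (μ +_) (zeroʳ (β z ⁻¹)) ⟩
          μ + 0#                                                ≡⟨ +-identityʳ μ ⟩
          μ                                                     ∎
          where open ≡-Reasoning

        S⇒TranslationOrFixing : ∀ {y z} → ¬ L z → S (y - z) → TranslationOrFixing (relSlope y z) (relShift y z)
        S⇒TranslationOrFixing {y} {z} z∉L y-z∈S = byCases (β y ≟ β z)
          where
          byCases : Dec (β y ≡ β z) → TranslationOrFixing (relSlope y z) (relShift y z)
          byCases (yes βy≡βz) = inj₁ (trans (cong (β z ⁻¹ *_) βy≡βz) (x⁻¹*x≡1 (proj₂ (β∈𝔽ᵣ* z∉L))))
          byCases (no βy≢βz)  = inj₂ (μ , μ∈A , relative-fixed⇐ (proj₂ (β∈𝔽ᵣ* z∉L)) dβμ+dα≡0)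
            where
            open ≡-Reasoning
            dα = α y - α z
            dβ = β y - β z
            dβ≢0 : dβ ≢ 0#
            dβ≢0 = x≢y⇒x-y≢0 βy≢βz
            μ = - (dβ ⁻¹ * dα)
            μ∈A : A μ
            μ∈A = S′⇒A (InFr-- (B.α-InFr (coord y)) (B.α-InFr (coord z))) (InFr-- (B.β-InFr (coord y)) (B.β-InFr (coord z)) , dβ≢0)
                       (subst S′ (coord-y-coord-z y z) (S⇔S′ y-z∈S))
            dβμ+dα≡0 : dβ * μ + dα ≡ 0#
            dβμ+dα≡0 = begin
              dβ * - (dβ ⁻¹ * dα) + dα
                ≡⟨ solve 3 (λ b i a → b :* :- (i :* a) :+ a := :- (b :* (i :* a)) :+ a) refl dβ (dβ ⁻¹) dα ⟩
              - (dβ * (dβ ⁻¹ * dα)) + dα     ≡⟨ cong (λ t → - t + dα) (x*[x⁻¹*y]≡y dα dβ≢0) ⟩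
              - dα + dα                      ≡⟨ -‿inverseˡ dα ⟩
              0#                             ∎

        TranslationOrFixing⇒S : ∀ {y z} → ¬ L z → y ≢ z → TranslationOrFixing (relSlope y z) (relShift y z) → S (y - z)
        TranslationOrFixing⇒S {y} {z} z∉L y≢z = byCases (β y ≟ β z)
          where
          open ≡-Reasoning
          dα = α y - α z
          dβ = β y - β z
          byCases : Dec (β y ≡ β z) → TranslationOrFixing (relSlope y z) (relShift y z) → S (y - z)
          byCases (yes βy≡βz) _ =
            S′⇒S (subst S′ dα≡coord-y-coord-z (InFr*⇒S′ (InFr-- (B.α-InFr (coord y)) (B.α-InFr (coord z)) , dα≢0)))
            where
            dα≡coord-y-coord-z : dα ≡ coord y - coord z
            dα≡coord-y-coord-z = sym (begin
              coord y - coord z              ≡⟨ coord-y-coord-z y z ⟩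
              dα + (β y - β z) * w           ≡⟨ cong (λ t → dα + (t - β z) * w) βy≡βz ⟩
              dα + (β z - β z) * w           ≡⟨ solve 3 (λ a b w → a :+ (b :- b) :* w := a) refl dα (β z) w ⟩
              dα                             ∎)
            dα≢0 : dα ≢ 0#
            dα≢0 dα≡0 = y≢z (coord-injective (x-y≡0⇒x≡y (trans (sym dα≡coord-y-coord-z) dα≡0)))
          byCases (no βy≢βz) (inj₁ relSlope≡1) = ⊥-elim (βy≢βz (begin
            β y                        ≡⟨ x*[x⁻¹*y]≡y (β y) (proj₂ (β∈𝔽ᵣ* z∉L)) ⟨
            β z * (β z ⁻¹ * β y)       ≡⟨ cong (β z *_) relSlope≡1 ⟩
            β z * 1#                   ≡⟨ *-identityʳ (β z) ⟩
            β z                        ∎))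
          byCases (no βy≢βz) (inj₂ (μ , (_ , w-μ∈S′) , fixed)) = S′⇒S (subst S′ (begin
            dβ * (w - μ)
              ≡⟨ solve 4 (λ b a μ w → b :* (w :- μ) := (a :+ b :* w) :- (b :* μ :+ a)) refl dβ dα μ w ⟩
            (dα + dβ * w) - (dβ * μ + dα)
              ≡⟨ cong (λ t → (dα + dβ * w) - t) (relative-fixed⇒ (proj₂ (β∈𝔽ᵣ* z∉L)) fixed) ⟩
            (dα + dβ * w) - 0#                  ≡⟨ solve 1 (λ t → t :- con (ℤ.+ 0) := t) refl (dα + dβ * w) ⟩
            dα + dβ * w                         ≡⟨ coord-y-coord-z y z ⟨
            coord y - coord z                   ∎)
            (S′-scale (InFr-- (B.β-InFr (coord y)) (B.β-InFr (coord z)) , x≢y⇒x-y≢0 βy≢βz) w-μ∈S′))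

        -- slope u v and shift u v encode h_v ∘ h_u⁻¹, and transfer u v acts on coordinates by this map.
        slope shift : K → K → K
        slope u v = β v * β u ⁻¹
        shift u v = β v * - (β u ⁻¹ * α u) + α v

        transfer : K → K → K → K
        transfer u v = liftAff (slope u v) (shift u v)

        slope∈𝔽ᵣ* : ∀ {u v} → ¬ L u → ¬ L v → InFr* (slope u v)
        slope∈𝔽ᵣ* u∉L v∉L = InFr*-* (β∈𝔽ᵣ* v∉L) (InFr*-⁻¹ (β∈𝔽ᵣ* u∉L))

        shift∈𝔽ᵣ : ∀ u v → InFr (shift u v)
        shift∈𝔽ᵣ u v = InFr-+ (InFr-* (B.β-InFr (coord v)) (InFr-neg (InFr-* (InFr-⁻¹ (B.β-InFr (coord u))) (B.α-InFr (coord u)))))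
                              (B.α-InFr (coord v))

        coord-transfer : ∀ u v z → coord (transfer u v z) ≡ (slope u v * α z + shift u v) + (slope u v * β z) * w
        coord-transfer u v z = begin
          coord (transfer u v z)                      ≡⟨ coord-liftAff (slope u v) (shift u v) z ⟩
          slope u v * coord z + shift u v             ≡⟨ cong (λ t → slope u v * t + shift u v) (coord≡α+βw z) ⟩
          slope u v * (α z + β z * w) + shift u v     ≡⟨ solve 5 (λ c a b w e → c :* (a :+ b :* w) :+ e := (c :* a :+ e) :+ (c :* b) :* w)
                                                           refl (slope u v) (α z) (β z) w (shift u v) ⟩
          (slope u v * α z + shift u v) + (slope u v * β z) * w ∎
          where open ≡-Reasoning

        αβ-transfer : ∀ u v z → α (transfer u v z) ≡ slope u v * α z + shift u v × β (transfer u v z) ≡ slope u v * β z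
        αβ-transfer u v z = B.basis-unique (B.α-InFr _) (B.β-InFr _)
          (InFr-+ (InFr-* c∈ (B.α-InFr (coord z))) (shift∈𝔽ᵣ u v)) (InFr-* c∈ (B.β-InFr (coord z)))
          (trans (sym (coord≡α+βw (transfer u v z))) (coord-transfer u v z))
          where c∈ = InFr-* (B.β-InFr (coord v)) (InFr-⁻¹ (B.β-InFr (coord u)))

        transfer-u≡v : ∀ {u v} → ¬ L u → transfer u v u ≡ v
        transfer-u≡v {u} {v} u∉L = coord-injective (begin
          coord (transfer u v u)                        ≡⟨ coord-liftAff (slope u v) (shift u v) u ⟩
          slope u v * coord u + shift u v               ≡⟨ cong (λ t → slope u v * t + shift u v) (coord≡α+βw u) ⟩
          slope u v * (α u + β u * w) + shift u v
            ≡⟨ solve 6 (λ b′ i a b w a′ → b′ :* i :* (a :+ b :* w) :+ (b′ :* :- (i :* a) :+ a′) := a′ :+ b′ :* (i :* b) :* w)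
                                                             refl (β v) (β u ⁻¹) (α u) (β u) w (α v) ⟩
          α v + β v * (β u ⁻¹ * β u) * w                ≡⟨ cong (λ t → α v + β v * t * w) (x⁻¹*x≡1 (proj₂ (β∈𝔽ᵣ* u∉L))) ⟩
          α v + β v * 1# * w                            ≡⟨ cong (λ t → α v + t * w) (*-identityʳ (β v)) ⟩
          α v + β v * w                                 ≡⟨ coord≡α+βw v ⟨
          coord v                                       ∎)
          where open ≡-Reasoning

        transfer-inverse : ∀ {u v} → ¬ L u → ¬ L v → ∀ z → transfer u v (transfer v u z) ≡ z
        transfer-inverse {u} {v} u∉L v∉L z = coord-injective (begin
          coord (transfer u v (transfer v u z))
            ≡⟨ coord-liftAff (slope u v) (shift u v) _ ⟩
          slope u v * coord (transfer v u z) + shift u v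
            ≡⟨ cong (λ t → slope u v * t + shift u v) (coord-liftAff (slope v u) (shift v u) z) ⟩
          slope u v * (slope v u * coord z + shift v u) + shift u v
            ≡⟨ solve 7 (λ b iu b′ iv t a a′ → (b′ :* iu) :* ((b :* iv) :* t :+ (b :* :- (iv :* a′) :+ a))
                                               :+ (b′ :* :- (iu :* a) :+ a′)
                         := ((iu :* b) :* (b′ :* iv)) :* t :+ a′ :* (:1 :- (iu :* b) :* (b′ :* iv)))
                 refl (β u) (β u ⁻¹) (β v) (β v ⁻¹) (coord z) (α u) (α v) ⟩
          (β u ⁻¹ * β u) * (β v * β v ⁻¹) * coord z + α v * (1# - (β u ⁻¹ * β u) * (β v * β v ⁻¹))
            ≡⟨ cong₂ (λ s t → s * t * coord z + α v * (1# - s * t))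
                 (x⁻¹*x≡1 (proj₂ (β∈𝔽ᵣ* u∉L))) (x*x⁻¹≡1 (proj₂ (β∈𝔽ᵣ* v∉L))) ⟩
          1# * 1# * coord z + α v * (1# - 1# * 1#)
            ≡⟨ solve 2 (λ t a → :1 :* :1 :* t :+ a :* (:1 :- :1 :* :1) := t) refl (coord z) (α v) ⟩
          coord z ∎)
          where open ≡-Reasoning

        relative-transfer : ∀ u v y z → relSlope (transfer u v z) y ≡ relSlope v y * relSlope z u
                                      × relShift (transfer u v z) y ≡ relSlope v y * relShift z u + relShift v y
        relative-transfer u v y z =
          trans (cong (β y ⁻¹ *_) (proj₂ (αβ-transfer u v z)))
                (solve 4 (λ iy b′ iu b → iy :* (b′ :* iu :* b) := iy :* b′ :* (iu :* b)) refl (β y ⁻¹) (β v) (β u ⁻¹) (β z)) ,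
          trans (cong (λ t → β y ⁻¹ * t - β y ⁻¹ * α y) (proj₁ (αβ-transfer u v z)))
                (solve 7 (λ iy b′ iu a a₀ a′ aʸ → iy :* (b′ :* iu :* a :+ (b′ :* :- (iu :* a₀) :+ a′)) :- iy :* aʸ
                            := iy :* b′ :* (iu :* a :- iu :* a₀) :+ (iy :* a′ :- iy :* aʸ))
                   refl (β y ⁻¹) (β v) (β u ⁻¹) (α z) (α u) (α v) (α y))

        module InClique (C : K → Set) (C-maximal : IsMaximalClique S C) (x∈C : C x)
                        (x⊥∩L⊆C : ∀ z → L z → Perp S x z → C z) where
          private
            C-clique : IsClique S C
            C-clique = proj₁ C-maximal

            ∉L⇒≢ : ∀ {y z} → ¬ L y → L z → y ≢ z
            ∉L⇒≢ y∉L z∈L refl = y∉L z∈L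

          A⇒C : ∀ {t} → A t → C (point t)
          A⇒C {t} (t∈𝔽ᵣ , w-t∈S′) = x⊥∩L⊆C (point t) t∈L (inj₂ (∉L⇒≢ x∉L t∈L ,
            S′⇒S (subst (λ s → S′ (w - s)) (sym (coord-point t)) w-t∈S′)))
            where
            t∈L : L (point t)
            t∈L = t , t∈𝔽ᵣ , refl

          C∩L⇒A : ∀ {z} → C z → L z → A (coord z)
          C∩L⇒A z∈C z∈L = L⇒InFr z∈L , S⇔S′ (proj₂ (C-clique _ _ x∈C z∈C (∉L⇒≢ x∉L z∈L)))

          -- z is adjacent to the points of L with coordinate in A, which says that h_z⁻¹ maps A into A.
          h-reflects : ∀ {z} → C z → ¬ L z → Reflects (β z) (α z)
          h-reflects {z} z∈C z∉L ν hν∈A = subst A (begin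
            - (β z ⁻¹ * (α z - t))
              ≡⟨ solve 4 (λ i a b ν → :- (i :* (a :- (b :* ν :+ a))) := i :* (b :* ν)) refl (β z ⁻¹) (α z) (β z) ν ⟩
            β z ⁻¹ * (β z * ν)           ≡⟨ x⁻¹*[x*y]≡y ν (proj₂ (β∈𝔽ᵣ* z∉L)) ⟩
            ν                            ∎)
            (S′⇒A (InFr-- (B.α-InFr (coord z)) (proj₁ hν∈A)) (β∈𝔽ᵣ* z∉L) (subst S′ coord-z-t≡ (S⇔S′ z-t∈S)))
            where
            open ≡-Reasoning
            t = β z * ν + α z
            z-t∈S : S (z - point t)
            z-t∈S = proj₂ (C-clique _ _ z∈C (A⇒C hν∈A) (∉L⇒≢ z∉L (t , proj₁ hν∈A , refl)))
            coord-z-t≡ : coord z - coord (point t) ≡ (α z - t) + β z * w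
            coord-z-t≡ = begin
              coord z - coord (point t)     ≡⟨ cong₂ _-_ (coord≡α+βw z) (coord-point t) ⟩
              (α z + β z * w) - t           ≡⟨ solve 4 (λ a b w t → (a :+ b :* w) :- t := (a :- t) :+ b :* w) refl (α z) (β z) w t ⟩
              (α z - t) + β z * w           ∎

          h-preserves : ∀ {z} → C z → ¬ L z → Preserves (β z) (α z)
          h-preserves z∈C z∉L = reflects⇒preserves (β∈𝔽ᵣ* z∉L) (h-reflects z∈C z∉L)

          h⁻¹-preserves : ∀ {z} → C z → ¬ L z → Preserves (β z ⁻¹) (- (β z ⁻¹ * α z))
          h⁻¹-preserves z∈C z∉L = reflects⇒inverse-preserves (proj₂ (β∈𝔽ᵣ* z∉L)) (h-reflects z∈C z∉L)

          relSlope∈𝔽ᵣ* : ∀ {y z} → ¬ L y → ¬ L z → InFr* (relSlope y z)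
          relSlope∈𝔽ᵣ* y∉L z∉L = InFr*-* (InFr*-⁻¹ (β∈𝔽ᵣ* z∉L)) (β∈𝔽ᵣ* y∉L)

          relative-preserves : ∀ {y z} → C y → ¬ L y → C z → ¬ L z → Preserves (relSlope y z) (relShift y z)
          relative-preserves y∈C y∉L z∈C z∉L = Preserves-∘ (h⁻¹-preserves z∈C z∉L) (h-preserves y∈C y∉L)

          C⇒TranslationOrFixing : ∀ {y z} → C y → C z → ¬ L z → TranslationOrFixing (relSlope y z) (relShift y z)
          C⇒TranslationOrFixing {y} {z} y∈C z∈C z∉L = byCases (y ≟ z)
            where
            byCases : Dec (y ≡ z) → TranslationOrFixing (relSlope y z) (relShift y z)
            byCases (yes refl) = inj₁ (x⁻¹*x≡1 (proj₂ (β∈𝔽ᵣ* z∉L)))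
            byCases (no y≢z)   = S⇒TranslationOrFixing z∉L (proj₂ (C-clique y z y∈C z∈C y≢z))

          module _ {u v} (u∈C : C u) (u∉L : ¬ L u) (v∈C : C v) (v∉L : ¬ L v) where

            transfer-C∩L : ∀ {z} → C z → L z → C (transfer u v z)
            transfer-C∩L {z} z∈C z∈L =
              subst C point≡gz (A⇒C (Preserves-∘ (h-preserves v∈C v∉L) (h⁻¹-preserves u∈C u∉L) _ (C∩L⇒A z∈C z∈L)))
              where
              point≡gz : point (slope u v * coord z + shift u v) ≡ transfer u v z
              point≡gz = trans (cong point (sym (coord-liftAff (slope u v) (shift u v) z))) (point-coord _)

          -- For z off L, maximality of C reduces g z ∈ C to adjacency with every y ∈ C: for y on L through the
          -- inverse transfer, and for y off L because h_y⁻¹ ∘ h_{g z} = (h_y⁻¹ ∘ h_v) ∘ (h_u⁻¹ ∘ h_z).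
          transfer-C : ∀ {u v z} → C u → ¬ L u → C v → ¬ L v → C z → C (transfer u v z)
          transfer-C {u} {v} {z} u∈C u∉L v∈C v∉L z∈C = byCases (InFr? (coord z))
            where
            g = transfer u v
            byCases : Dec (InFr (coord z)) → C (g z)
            byCases (yes z∈𝔽ᵣ) = transfer-C∩L u∈C u∉L v∈C v∉L z∈C (InFr⇒L z∈𝔽ᵣ)
            byCases (no z∉𝔽ᵣ)  = adjacent-to-all⇒∈ C-maximal (λ y y∈C y≢gz → gz~y y∈C y≢gz (InFr? (coord y)))
              where
              z∉L = z∉𝔽ᵣ ∘ L⇒InFr
              gz~y : ∀ {y} → C y → y ≢ g z → Dec (InFr (coord y)) → Adj S (g z) y
              gz~y {y} y∈C y≢gz (yes y∈𝔽ᵣ) = subst (Adj S (g z)) (transfer-inverse u∉L v∉L y)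
                (aff-Adj (slope∈𝔽ᵣ* u∉L v∉L) (C-clique z _ z∈C (transfer-C∩L v∈C v∉L u∈C u∉L y∈C y∈L)
                  (∉L⇒≢ z∉L (liftAff-L (slope∈𝔽ᵣ* v∉L u∉L) (shift∈𝔽ᵣ v u) y∈L))))
                where y∈L = InFr⇒L y∈𝔽ᵣ
              gz~y {y} y∈C y≢gz (no y∉𝔽ᵣ) = y≢gz ∘ sym , TranslationOrFixing⇒S y∉L (y≢gz ∘ sym)
                (subst₂ TranslationOrFixing (sym (proj₁ (relative-transfer u v y z))) (sym (proj₂ (relative-transfer u v y z)))
                  (TranslationOrFixing-∘ (relSlope∈𝔽ᵣ* v∉L y∉L) (relSlope∈𝔽ᵣ* z∉L u∉L)
                    (relative-preserves v∈C v∉L y∈C y∉L) (relative-preserves z∈C z∉L u∈C u∉L)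
                    (C⇒TranslationOrFixing v∈C y∈C y∉L) (C⇒TranslationOrFixing z∈C u∈C u∉L)))
                where y∉L = y∉𝔽ᵣ ∘ L⇒InFr

          C-transitive : ∀ u v → C u → ¬ L u → C v → ¬ L v →
                         ∃ λ c → ∃ λ e → InFr* c × Stabilizes (aff c e) L × Stabilizes (aff c e) C × aff c e u ≡ v
          C-transitive u v u∈C u∉L v∈C v∉L = slope u v , _ , c∈ , stabilizes-L , stabilizes-C , transfer-u≡v u∉L
            where
            c∈ = slope∈𝔽ᵣ* u∉L v∉L
            stabilizes-L : Stabilizes (transfer u v) L
            stabilizes-L z = liftAff-L c∈ (shift∈𝔽ᵣ u v) , liftAff-L⁻¹ c∈ (shift∈𝔽ᵣ u v)
            stabilizes-C : Stabilizes (transfer u v) C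
            stabilizes-C z = transfer-C u∈C u∉L v∈C v∉L ,
              λ gz∈C → subst C (transfer-inverse v∉L u∉L z) (transfer-C v∈C v∉L u∈C u∉L gz∈C)

open import Data.Nat using (_≥_; _*_; _^_)

proposition4 : (p k r : ℕ) → Prime p → r ≡ p ^ suc k →
    (F : FiniteField (r * r)) → let open Net {r} F in
    (m : ℕ) → m ≥ 1 → (S : K → Set) → IsDirectionSet m S →
    (a d : K) → S d → (x : K) → ¬ OnLine a d x →
    (C : K → Set) → IsMaximalClique S C → C x →
    (∀ z → OnLine a d z → Perp S x z → C z) →
    ∀ u v → C u → ¬ OnLine a d u → C v → ¬ OnLine a d v →
    ∃ λ c → ∃ λ e → InFr* c
    × Stabilizes (aff c e) (OnLine a d)
    × Stabilizes (aff c e) C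
    × aff c e u ≡ v
proposition4 p k r p-prime r≡p^[1+k] F _ _ S isDirectionSet a d d∈S x x∉L C C-maximal x∈C x⊥∩L⊆C =
  InClique.C-transitive C C-maximal x∈C x⊥∩L⊆C
  where
  open NetGeometry {p} {k} {r} p-prime r≡p^[1+k] F
  open OnNet S (directionSet-nonzero isDirectionSet) (directionSet-scale isDirectionSet)
  open Coordinates a d d∈S
  open OffLine x x∉L
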